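{- Let $t$ be a positive integer and $n$ an integer with $1<n<\frac{15+\sqrt{33}}{24}t^2$. If $M$ is an $n\times n$ $t$-disjunct matrix, then $M$ is a permutation matrix. Equivalently, if $\mathcal F\subseteq2^{[n]}$ is a $t$-cover-free family of size $n$, then $\mathcal F=\{\{1\},\{2\},\dots,\{n\}\}$.
   Context: A family $\mathcal F\subseteq2^{[n]}$ is $t$-cover-free if $A_0\not\subseteq A_1\cup\dots\cup A_r$ for all distinct $A_0,\dots,A_r\in\mathcal F$ with $r\le t$. The incidence matrix of $\mathcal F=\{F_1,\dots,F_w\}$ is the $n\times w$ $0/1$ matrix $M$ with $M(u,v)=1$ iff $u\in F_v$. A binary matrix is $t$-disjunct if it is the incidence matrix of a $t$-cover-free family; equivalently, its columns are distinct and for every $j\le t$ the Boolean sum of any $j$ columns does not contain any other column. -}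

module Defs where

open import Data.Nat using (ℕ; suc; _+_; _*_; _^_; _≤_; _<_)
open import Data.Bool using (Bool; true)
open import Data.Fin using (Fin)
open import Data.List using (List; length)
open import Data.List.Membership.Propositional using (_∈_; _∉_)
open import Data.Product using (Σ; ∃; _×_)
open import Data.Sum using (_⊎_)
open import Relation.Nullary using (¬_)
open import Relation.Binary.PropositionalEquality using (_≡_)
open import Function.Bundles using (_↔_; _⇔_; Inverse)

-- A binary n × w matrix: M u v is the entry in row u, column v.
Matrix : ℕ → ℕ → Set
Matrix n w = Fin n → Fin w → Bool

ColContainedInSum : ∀ {n w} → Matrix n w → Fin w → List (Fin w) → Set
ColContainedInSum M i S =
  ∀ u → M u i ≡ true → ∃ λ j → (j ∈ S) × (M u j ≡ true)

DistinctColumns : ∀ {n w} → Matrix n w → Set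
DistinctColumns M = ∀ i j → ¬ (i ≡ j) → ¬ (∀ u → M u i ≡ M u j)

Disjunct : ℕ → ∀ {n w} → Matrix n w → Set
Disjunct t M =
  DistinctColumns M ×
  (∀ (i : Fin _) (S : List (Fin _)) → length S ≤ t → i ∉ S →
     ¬ ColContainedInSum M i S)

IsPermutationMatrix : ∀ {n} → Matrix n n → Set
IsPermutationMatrix {n} M =
  Σ (Fin n ↔ Fin n) λ σ → ∀ u v → (M u v ≡ true ⇔ u ≡ Inverse.to σ v)

-- n < ((15 + √33)/24) t², i.e. 24 n < 15 t² + √33 t², stated over ℕ:
-- either 24 n ≤ 15 t², or 24 n = 15 t² + d with d² < 33 t⁴.
BelowBound : ℕ → ℕ → Set
BelowBound t n =
  (24 * n ≤ 15 * t ^ 2) ⊎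
  (∃ λ d → (24 * n ≡ 15 * t ^ 2 + d) × (d ^ 2 < 33 * t ^ 4))

module Submission where

-- Call a column heavy if it has at least two ones.  By induction on t, a t-cover-free matrix with
-- a heavy column and no more rows than columns has at least θ t² rows, θ = (15 + √33)/24; so
-- below that bound every column has a single one, and distinct columns make a permutation.
-- Step: deleting a heaviest column (s ones) and its rows leaves a (t - 1)-cover-free matrix with
-- fewer rows than columns, hence with a heavy column and at least θ (t - 1)² rows; so we may assume
-- s < θ (2t - 1).  Counting private rows (rows meeting a single column) yields a column A without
-- private rows that owns fewer pairs of rows than there are rows, a pair being owned by A if no
-- other column contains both.  Join two rows of A when another column contains both: a matching of
-- k edges with |A| ≤ k + t gives t columns covering A, so by the Erdős–Gallai bound (proved by
-- shifting) A owns at least (t - j)(t + 3j + 1) pairs for some j < |A| - t, and since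
-- |A| ≤ s < θ (2t - 1) this is at least θ t² - 1.

open import Data.Nat using (ℕ)
open import Data.Bool using (Bool)

module Counting where

  open import Data.Nat
  open import Data.Nat.Properties
  open import Data.Bool using (Bool; true; false; _∧_; _∨_; not; if_then_else_)
  open import Data.Bool.Properties using (∨-zeroʳ; ∧-zeroʳ; ∧-identityʳ) renaming (_≟_ to _≟ᵇ_)
  open import Data.Product using (∃; _×_; _,_; proj₁; proj₂)
  open import Data.Sum using (_⊎_; inj₁; inj₂; [_,_]′)
  open import Data.Empty using (⊥-elim)
  open import Relation.Nullary using (¬_; Dec; yes; no; does)
  open import Relation.Nullary.Decidable using (dec-true; dec-false)
  open import Relation.Binary.PropositionalEquality
  open import Data.List using (List; []; _∷_; length)
  open import Data.List.Relation.Unary.All as All using (All; []; _∷_)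

  true≢false : true ≢ false
  true≢false ()

  ∧-true⁻ : ∀ {a b} → a ∧ b ≡ true → a ≡ true × b ≡ true
  ∧-true⁻ {true} {true} _ = refl , refl

  ∧-true⁺ : ∀ {a b} → a ≡ true → b ≡ true → a ∧ b ≡ true
  ∧-true⁺ refl refl = refl

  ∧-implied : ∀ {a b} → (a ≡ true → b ≡ true) → a ∧ b ≡ a
  ∧-implied {true} a⇒b = a⇒b refl
  ∧-implied {false} _ = refl

  ∨-true⁻ : ∀ {a b} → a ∨ b ≡ true → a ≡ true ⊎ b ≡ true
  ∨-true⁻ {true} _ = inj₁ refl
  ∨-true⁻ {false} e = inj₂ e

  ∨-false⁻ : ∀ {a b} → a ∨ b ≡ false → a ≡ false × b ≡ false
  ∨-false⁻ {false} {false} _ = refl , refl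

  not-true⁻ : ∀ {a} → not a ≡ true → a ≡ false
  not-true⁻ {false} _ = refl

  not-true⁺ : ∀ {a} → a ≡ false → not a ≡ true
  not-true⁺ refl = refl

  not-false⁻ : ∀ {a} → not a ≡ false → a ≡ true
  not-false⁻ {true} _ = refl

  does-true⁻ : ∀ {A : Set} (a? : Dec A) → does a? ≡ true → A
  does-true⁻ (yes a) _ = a

  ≡ᵇ-refl : ∀ a → (a ≡ᵇ a) ≡ true
  ≡ᵇ-refl a = dec-true (a ≟ a) refl

  ≡ᵇ-true⁻ : ∀ {a b} → (a ≡ᵇ b) ≡ true → a ≡ b
  ≡ᵇ-true⁻ {a} {b} = does-true⁻ (a ≟ b)

  ≡ᵇ-false⁺ : ∀ {a b} → a ≢ b → (a ≡ᵇ b) ≡ false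
  ≡ᵇ-false⁺ {a} {b} = dec-false (a ≟ b)

  ≡ᵇ-false⁻ : ∀ {a b} → (a ≡ᵇ b) ≡ false → a ≢ b
  ≡ᵇ-false⁻ {a} e refl = true≢false (trans (sym (≡ᵇ-refl a)) e)

  ≡ᵇ-sym : ∀ a b → (a ≡ᵇ b) ≡ (b ≡ᵇ a)
  ≡ᵇ-sym zero zero = refl
  ≡ᵇ-sym zero (suc b) = refl
  ≡ᵇ-sym (suc a) zero = refl
  ≡ᵇ-sym (suc a) (suc b) = ≡ᵇ-sym a b

  ≤ᵇ-true⁺ : ∀ {m n} → m ≤ n → (m ≤ᵇ n) ≡ true
  ≤ᵇ-true⁺ {m} {n} = dec-true (m ≤? n)

  ≤ᵇ-false⁺ : ∀ {m n} → ¬ m ≤ n → (m ≤ᵇ n) ≡ false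
  ≤ᵇ-false⁺ {m} {n} = dec-false (m ≤? n)

  ≤ᵇ-true⁻ : ∀ {m n} → (m ≤ᵇ n) ≡ true → m ≤ n
  ≤ᵇ-true⁻ {m} {n} = does-true⁻ (m ≤? n)

  <ᵇ-true⁺ : ∀ {m n} → m < n → (m <ᵇ n) ≡ true
  <ᵇ-true⁺ {m} {n} = dec-true (m <? n)

  <ᵇ-false⁺ : ∀ {m n} → ¬ m < n → (m <ᵇ n) ≡ false
  <ᵇ-false⁺ {m} {n} = dec-false (m <? n)

  ∑< : ℕ → (ℕ → ℕ) → ℕ
  ∑< zero f = 0
  ∑< (suc n) f = ∑< n f + f n

  syntax ∑< n (λ x → e) = ∑[ x < n ] e

  𝟙 : Bool → ℕ
  𝟙 true = 1
  𝟙 false = 0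

  𝟙≤1 : ∀ b → 𝟙 b ≤ 1
  𝟙≤1 true = ≤-refl
  𝟙≤1 false = z≤n

  count : ℕ → (ℕ → Bool) → ℕ
  count n P = ∑[ x < n ] 𝟙 (P x)

  private
    <-weaken : ∀ {n} {P : ℕ → Set} → (∀ x → x < suc n → P x) → ∀ x → x < n → P x
    <-weaken h x x<n = h x (m<n⇒m<1+n x<n)

    <suc-cases : ∀ {x n} → x < suc n → x < n ⊎ x ≡ n
    <suc-cases x<1+n = m≤n⇒m<n∨m≡n (s≤s⁻¹ x<1+n)

  ∑-cong : ∀ n {f g : ℕ → ℕ} → (∀ x → x < n → f x ≡ g x) → ∑< n f ≡ ∑< n g
  ∑-cong zero h = refl
  ∑-cong (suc n) h = cong₂ _+_ (∑-cong n (<-weaken h)) (h n ≤-refl)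

  ∑-mono-≤ : ∀ n {f g : ℕ → ℕ} → (∀ x → x < n → f x ≤ g x) → ∑< n f ≤ ∑< n g
  ∑-mono-≤ zero h = z≤n
  ∑-mono-≤ (suc n) h = +-mono-≤ (∑-mono-≤ n (<-weaken h)) (h n ≤-refl)

  ∑-zero : ∀ n {f : ℕ → ℕ} → (∀ x → x < n → f x ≡ 0) → ∑< n f ≡ 0
  ∑-zero zero h = refl
  ∑-zero (suc n) h = cong₂ _+_ (∑-zero n (<-weaken h)) (h n ≤-refl)

  ∑-distrib-+ : ∀ n (f g : ℕ → ℕ) → ∑[ x < n ] (f x + g x) ≡ ∑< n f + ∑< n g
  ∑-distrib-+ zero f g = refl
  ∑-distrib-+ (suc n) f g = begin
    ∑[ x < n ] (f x + g x) + (f n + g n) ≡⟨ cong (_+ (f n + g n)) (∑-distrib-+ n f g) ⟩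
    (∑< n f + ∑< n g) + (f n + g n)       ≡⟨ +-comm-middle (∑< n f) (∑< n g) (f n) (g n) ⟩
    (∑< n f + f n) + (∑< n g + g n)       ∎
    where
    open ≡-Reasoning
    +-comm-middle : ∀ a b c d → (a + b) + (c + d) ≡ (a + c) + (b + d)
    +-comm-middle a b c d = begin
      (a + b) + (c + d) ≡⟨ +-assoc a b (c + d) ⟩
      a + (b + (c + d)) ≡⟨ cong (a +_) (+-comm b (c + d)) ⟩
      a + ((c + d) + b) ≡⟨ cong (a +_) (+-assoc c d b) ⟩
      a + (c + (d + b)) ≡⟨ cong (λ z → a + (c + z)) (+-comm d b) ⟩
      a + (c + (b + d)) ≡⟨ +-assoc a c (b + d) ⟨
      (a + c) + (b + d) ∎

  ∑-comm : ∀ n m (f : ℕ → ℕ → ℕ) → ∑[ x < n ] ∑[ y < m ] f x y ≡ ∑[ y < m ] ∑[ x < n ] f x y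
  ∑-comm zero m f = sym (∑-zero m (λ _ _ → refl))
  ∑-comm (suc n) m f = begin
    ∑[ x < n ] ∑[ y < m ] f x y + ∑[ y < m ] f n y ≡⟨ cong (_+ ∑[ y < m ] f n y) (∑-comm n m f) ⟩
    ∑[ y < m ] ∑[ x < n ] f x y + ∑[ y < m ] f n y ≡⟨ ∑-distrib-+ m (λ y → ∑[ x < n ] f x y) (f n) ⟨
    ∑[ y < m ] (∑[ x < n ] f x y + f n y)          ∎
    where open ≡-Reasoning

  ∑-const : ∀ n c → ∑[ x < n ] c ≡ n * c
  ∑-const zero c = refl
  ∑-const (suc n) c = trans (cong (_+ c) (∑-const n c)) (+-comm (n * c) c)

  ∑-*ˡ : ∀ n c (f : ℕ → ℕ) → ∑[ x < n ] (c * f x) ≡ c * ∑< n f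
  ∑-*ˡ zero c f = sym (*-zeroʳ c)
  ∑-*ˡ (suc n) c f = trans (cong (_+ c * f n) (∑-*ˡ n c f)) (sym (*-distribˡ-+ c (∑< n f) (f n)))

  except : ℕ → (ℕ → ℕ) → ℕ → ℕ
  except i f x = if x ≡ᵇ i then 0 else f x

  except-≢ : ∀ {i x} (f : ℕ → ℕ) → x ≢ i → except i f x ≡ f x
  except-≢ f x≢i rewrite ≡ᵇ-false⁺ x≢i = refl

  ∑-except : ∀ n i (f : ℕ → ℕ) → i < n → ∑< n f ≡ f i + ∑< n (except i f)
  ∑-except (suc n) i f i<1+n with <suc-cases i<1+n
  ... | inj₁ i<n = begin
    ∑< n f + f n                         ≡⟨ cong (_+ f n) (∑-except n i f i<n) ⟩
    f i + ∑< n (except i f) + f n        ≡⟨ +-assoc (f i) _ (f n) ⟩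
    f i + (∑< n (except i f) + f n)      ≡⟨ cong (λ z → f i + (∑< n (except i f) + z)) (except-≢ f (>⇒≢ i<n)) ⟨
    f i + ∑< (suc n) (except i f)        ∎
    where open ≡-Reasoning
  ... | inj₂ refl = begin
    ∑< i f + f i                         ≡⟨ +-comm (∑< i f) (f i) ⟩
    f i + ∑< i f                         ≡⟨ cong (f i +_) (∑-cong i (λ x x<i → except-≢ f (<⇒≢ x<i))) ⟨
    f i + ∑< i (except i f)              ≡⟨ cong (f i +_) (+-identityʳ _) ⟨
    f i + (∑< i (except i f) + 0)        ≡⟨ cong (λ z → f i + (∑< i (except i f) + z)) (except-self f) ⟨
    f i + ∑< (suc i) (except i f)        ∎
    where
    open ≡-Reasoning
    except-self : ∀ (f : ℕ → ℕ) → except i f i ≡ 0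
    except-self f rewrite ≡ᵇ-refl i = refl

  term≤∑ : ∀ n (f : ℕ → ℕ) {i} → i < n → f i ≤ ∑< n f
  term≤∑ n f {i} i<n = subst (f i ≤_) (sym (∑-except n i f i<n)) (m≤m+n (f i) _)

  ∑-mono-< : ∀ n {f g : ℕ → ℕ} {i} → i < n → (∀ x → x < n → f x ≤ g x) → f i < g i → ∑< n f < ∑< n g
  ∑-mono-< n {f} {g} {i} i<n f≤g fi<gi
    rewrite ∑-except n i f i<n | ∑-except n i g i<n = +-mono-<-≤ fi<gi (∑-mono-≤ n except-≤)
    where
    except-≤ : ∀ x → x < n → except i f x ≤ except i g x
    except-≤ x x<n with x ≡ᵇ i
    ... | true = z≤n
    ... | false = f≤g x x<n

  ∑-except₂ : ∀ n (f : ℕ → ℕ) {i j} → i < n → j < n → i ≢ j →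
              ∑< n f ≡ f i + f j + ∑< n (except j (except i f))
  ∑-except₂ n f {i} {j} i<n j<n i≢j
    rewrite ∑-except n i f i<n | ∑-except n j (except i f) j<n | ≡ᵇ-false⁺ (≢-sym i≢j) =
    sym (+-assoc (f i) (f j) _)

  module _ (n : ℕ) {f g : ℕ → ℕ} {i j : ℕ} (i<n : i < n) (j<n : j < n) (i≢j : i ≢ j) where

    private
      except₂-mono : (∀ x → x < n → x ≢ i → x ≢ j → f x ≤ g x) →
                     ∀ x → x < n → except j (except i f) x ≤ except j (except i g) x
      except₂-mono f≤g x x<n with x ≡ᵇ j in x≡ᵇj
      ... | true = z≤n
      ... | false with x ≡ᵇ i in x≡ᵇi
      ...   | true = z≤n
      ...   | false = f≤g x x<n (≡ᵇ-false⁻ x≡ᵇi) (≡ᵇ-false⁻ x≡ᵇj)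

    ∑-mono-≤-pair : (∀ x → x < n → x ≢ i → x ≢ j → f x ≤ g x) → f i + f j ≤ g i + g j → ∑< n f ≤ ∑< n g
    ∑-mono-≤-pair off on rewrite ∑-except₂ n f i<n j<n i≢j | ∑-except₂ n g i<n j<n i≢j =
      +-mono-≤ on (∑-mono-≤ n (except₂-mono off))

    ∑-mono-<-pair : (∀ x → x < n → x ≢ i → x ≢ j → f x ≤ g x) → f i + f j < g i + g j → ∑< n f < ∑< n g
    ∑-mono-<-pair off on rewrite ∑-except₂ n f i<n j<n i≢j | ∑-except₂ n g i<n j<n i≢j =
      +-mono-<-≤ on (∑-mono-≤ n (except₂-mono off))

  ∑-cong-pair : ∀ n {f g : ℕ → ℕ} {i j} → i < n → j < n → i ≢ j →
                (∀ x → x < n → x ≢ i → x ≢ j → f x ≡ g x) → f i + f j ≡ g i + g j → ∑< n f ≡ ∑< n g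
  ∑-cong-pair n i<n j<n i≢j off on = ≤-antisym
    (∑-mono-≤-pair n i<n j<n i≢j (λ x x<n x≢i x≢j → ≤-reflexive (off x x<n x≢i x≢j)) (≤-reflexive on))
    (∑-mono-≤-pair n i<n j<n i≢j (λ x x<n x≢i x≢j → ≤-reflexive (sym (off x x<n x≢i x≢j))) (≤-reflexive (sym on)))

  2≤∑ : ∀ n (f : ℕ → ℕ) {u v} → u < n → v < n → u ≢ v → 1 ≤ f u → 1 ≤ f v → 2 ≤ ∑< n f
  2≤∑ n f u<n v<n u≢v 1≤fu 1≤fv rewrite ∑-except₂ n f u<n v<n u≢v =
    ≤-trans (+-mono-≤ 1≤fu 1≤fv) (m≤m+n _ _)

  count-true : ∀ n → count n (λ _ → true) ≡ n
  count-true n = trans (∑-const n 1) (*-identityʳ n)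

  count-split : ∀ n (P Q : ℕ → Bool) →
                count n P ≡ count n (λ x → P x ∧ Q x) + count n (λ x → P x ∧ not (Q x))
  count-split n P Q = trans (∑-cong n (λ x _ → 𝟙-split (P x) (Q x))) (∑-distrib-+ n _ _)
    where
    𝟙-split : ∀ p q → 𝟙 p ≡ 𝟙 (p ∧ q) + 𝟙 (p ∧ not q)
    𝟙-split true true = refl
    𝟙-split true false = refl
    𝟙-split false _ = refl

  count-mono : ∀ n {P Q : ℕ → Bool} → (∀ x → x < n → P x ≡ true → Q x ≡ true) → count n P ≤ count n Q
  count-mono n {P} {Q} P⇒Q = ∑-mono-≤ n 𝟙-mono
    where
    𝟙-mono : ∀ x → x < n → 𝟙 (P x) ≤ 𝟙 (Q x)
    𝟙-mono x x<n with P x in Px | Q x in Qx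
    ... | false | _ = z≤n
    ... | true | true = ≤-refl
    ... | true | false = ⊥-elim (true≢false (trans (sym (P⇒Q x x<n Px)) Qx))

  count-none : ∀ n {P : ℕ → Bool} → (∀ x → x < n → P x ≡ false) → count n P ≡ 0
  count-none n none = ∑-zero n (λ x x<n → cong 𝟙 (none x x<n))

  count-unique : ∀ n {P : ℕ → Bool} → (∀ x y → x < n → y < n → P x ≡ true → P y ≡ true → x ≡ y) →
                 count n P ≤ 1
  count-unique zero _ = z≤n
  count-unique (suc n) {P} unique with P n in Pn
  ... | false = ≤-trans (≤-reflexive (+-identityʳ _))
                  (count-unique n (λ x y x<n y<n → unique x y (m<n⇒m<1+n x<n) (m<n⇒m<1+n y<n)))
  ... | true = ≤-reflexive (cong (_+ 1) (count-none n only-n))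
    where
    only-n : ∀ x → x < n → P x ≡ false
    only-n x x<n with P x in Px
    ... | false = refl
    ... | true = ⊥-elim (<⇒≢ x<n (unique x n (m<n⇒m<1+n x<n) ≤-refl Px Pn))

  count-≡ᵇ : ∀ n {a} → a < n → count n (_≡ᵇ a) ≡ 1
  count-≡ᵇ n {a} a<n = ≤-antisym
    (count-unique n (λ x y _ _ x≡a y≡a → trans (≡ᵇ-true⁻ x≡a) (sym (≡ᵇ-true⁻ y≡a))))
    (subst (_≤ count n (_≡ᵇ a)) (cong 𝟙 (≡ᵇ-refl a)) (term≤∑ n (λ x → 𝟙 (x ≡ᵇ a)) a<n))

  count-injection : ∀ n₁ n₂ {P₁ P₂ : ℕ → Bool} (f : ℕ → ℕ) →
    (∀ i → i < n₁ → P₁ i ≡ true → f i < n₂ × P₂ (f i) ≡ true) →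
    (∀ i i' → i < n₁ → i' < n₁ → P₁ i ≡ true → P₁ i' ≡ true → f i ≡ f i' → i ≡ i') →
    count n₁ P₁ ≤ count n₂ P₂
  count-injection n₁ n₂ {P₁} {P₂} f maps-to injective = begin
    count n₁ P₁                          ≡⟨ ∑-cong n₁ fibre-of ⟩
    ∑[ i < n₁ ] count n₂ (hits i)        ≡⟨ ∑-comm n₁ n₂ (λ i u → 𝟙 (hits i u)) ⟩
    ∑[ u < n₂ ] count n₁ (λ i → hits i u) ≤⟨ ∑-mono-≤ n₂ fibre≤1 ⟩
    count n₂ P₂                          ∎
    where
    open ≤-Reasoning
    hits : ℕ → ℕ → Bool
    hits i u = P₁ i ∧ (u ≡ᵇ f i)

    fibre-of : ∀ i → i < n₁ → 𝟙 (P₁ i) ≡ count n₂ (hits i)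
    fibre-of i i<n₁ with P₁ i in P₁i
    ... | true = sym (count-≡ᵇ n₂ (proj₁ (maps-to i i<n₁ P₁i)))
    ... | false = sym (count-none n₂ (λ _ _ → refl))

    hit⇒ : ∀ i u → hits i u ≡ true → P₁ i ≡ true × u ≡ f i
    hit⇒ i u h = let (P₁i , u≡fi) = ∧-true⁻ h in P₁i , ≡ᵇ-true⁻ u≡fi

    fibre≤1 : ∀ u → u < n₂ → count n₁ (λ i → hits i u) ≤ 𝟙 (P₂ u)
    fibre≤1 u u<n₂ with P₂ u in P₂u
    ... | true = count-unique n₁ λ x y x<n₁ y<n₁ hx hy →
          let (P₁x , u≡fx) = hit⇒ x u hx ; (P₁y , u≡fy) = hit⇒ y u hy
          in injective x y x<n₁ y<n₁ P₁x P₁y (trans (sym u≡fx) u≡fy)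
    ... | false = ≤-reflexive (count-none n₁ no-hit)
      where
      no-hit : ∀ i → i < n₁ → hits i u ≡ false
      no-hit i i<n₁ with hits i u in hit
      ... | false = refl
      ... | true = let (P₁i , u≡fi) = hit⇒ i u hit in
        ⊥-elim (true≢false (trans (sym (proj₂ (maps-to i i<n₁ P₁i))) (trans (cong P₂ (sym u≡fi)) P₂u)))

  argmax : ∀ n (P : ℕ → Bool) (f : ℕ → ℕ) → (∃ λ i → i < n × P i ≡ true) →
           ∃ λ a → a < n × P a ≡ true × (∀ i → i < n → P i ≡ true → f i ≤ f a)
  argmax (suc n) P f (i , i<1+n , Pi) with anyUpTo? (λ x → P x ≟ᵇ true) n
  ... | no none = n , ≤-refl , Pn , maximal
    where
    Pn : P n ≡ true
    Pn with <suc-cases i<1+n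
    ... | inj₁ i<n = ⊥-elim (none (i , i<n , Pi))
    ... | inj₂ refl = Pi
    maximal : ∀ x → x < suc n → P x ≡ true → f x ≤ f n
    maximal x x<1+n Px with <suc-cases x<1+n
    ... | inj₁ x<n = ⊥-elim (none (x , x<n , Px))
    ... | inj₂ refl = ≤-refl
  ... | yes witness with argmax n P f witness
  ...   | a , a<n , Pa , a-max with P n in Pn | f a <? f n
  ...     | true | yes fa<fn = n , ≤-refl , Pn , λ x x<1+n Px →
    [ (λ x<n → ≤-trans (a-max x x<n Px) (<⇒≤ fa<fn)) , (λ { refl → ≤-refl }) ]′ (<suc-cases x<1+n)
  ...     | true | no fa≮fn = a , m<n⇒m<1+n a<n , Pa , λ x x<1+n Px →
    [ (λ x<n → a-max x x<n Px) , (λ { refl → ≮⇒≥ fa≮fn }) ]′ (<suc-cases x<1+n)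
  ...     | false | _ = a , m<n⇒m<1+n a<n , Pa , λ x x<1+n Px →
    [ (λ x<n → a-max x x<n Px) , (λ { refl → ⊥-elim (true≢false (trans (sym Px) Pn)) }) ]′ (<suc-cases x<1+n)

  all< : ℕ → (ℕ → Bool) → Bool
  all< zero f = true
  all< (suc n) f = all< n f ∧ f n

  any< : ℕ → (ℕ → Bool) → Bool
  any< zero f = false
  any< (suc n) f = any< n f ∨ f n

  all<-true⁻ : ∀ n {f : ℕ → Bool} → all< n f ≡ true → ∀ x → x < n → f x ≡ true
  all<-true⁻ (suc n) {f} h x x<1+n with ∧-true⁻ {all< n f} h | <suc-cases x<1+n
  ... | below , _ | inj₁ x<n = all<-true⁻ n below x x<n
  ... | _ , fn | inj₂ refl = fn

  all<-false⁻ : ∀ n {f : ℕ → Bool} → all< n f ≡ false → ∃ λ x → x < n × f x ≡ false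
  all<-false⁻ (suc n) {f} h with all< n f in below | f n in fn
  ... | false | _ = let (x , x<n , fx) = all<-false⁻ n below in x , m<n⇒m<1+n x<n , fx
  ... | true | false = n , ≤-refl , fn

  any<-true⁻ : ∀ n {f : ℕ → Bool} → any< n f ≡ true → ∃ λ x → x < n × f x ≡ true
  any<-true⁻ (suc n) {f} h with any< n f in below | f n in fn
  ... | true | _ = let (x , x<n , fx) = any<-true⁻ n below in x , m<n⇒m<1+n x<n , fx
  ... | false | true = n , ≤-refl , fn

  any<-true⁺ : ∀ n {f : ℕ → Bool} x → x < n → f x ≡ true → any< n f ≡ true
  any<-true⁺ (suc n) {f} x x<1+n fx with <suc-cases x<1+n
  ... | inj₁ x<n rewrite any<-true⁺ n {f} x x<n fx = refl
  ... | inj₂ refl rewrite fx = ∨-zeroʳ (any< n f)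

  any<-false⁻ : ∀ n {f : ℕ → Bool} → any< n f ≡ false → ∀ x → x < n → f x ≡ false
  any<-false⁻ n {f} h x x<n with f x in fx
  ... | false = refl
  ... | true = ⊥-elim (true≢false (trans (sym (any<-true⁺ n x x<n fx)) h))

  any<-cong : ∀ n {f g : ℕ → Bool} → (∀ x → f x ≡ g x) → any< n f ≡ any< n g
  any<-cong zero f≗g = refl
  any<-cong (suc n) f≗g = cong₂ _∨_ (any<-cong n f≗g) (f≗g n)

  pick : ℕ → (ℕ → Bool) → ℕ
  pick zero f = 0
  pick (suc n) f = if f n then n else pick n f

  pick-spec : ∀ n {f : ℕ → Bool} x → x < n → f x ≡ true → pick n f < n × f (pick n f) ≡ true
  pick-spec (suc n) {f} x x<1+n fx with f n in fn
  ... | true = ≤-refl , fn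
  ... | false with <suc-cases x<1+n
  ...   | inj₁ x<n = let (p<n , fp) = pick-spec n x x<n fx in m<n⇒m<1+n p<n , fp
  ...   | inj₂ refl = ⊥-elim (true≢false (trans (sym fx) fn))

  count-≥ : ∀ s m → count s (m ≤ᵇ_) ≡ s ∸ m
  count-≥ zero m = sym (0∸n≡0 m)
  count-≥ (suc s) m with m ≤? s
  ... | yes m≤s rewrite count-≥ s m | ≤ᵇ-true⁺ m≤s = trans (+-comm _ 1) (sym (+-∸-assoc 1 m≤s))
  ... | no m≰s rewrite count-≥ s m | ≤ᵇ-false⁺ m≰s | m≤n⇒m∸n≡0 (<⇒≤ (≰⇒> m≰s)) | m≤n⇒m∸n≡0 (≰⇒> m≰s) = refl

  count-remove : ∀ n {P : ℕ → Bool} {a} → a < n → P a ≡ true → count n P ≡ suc (count n (λ x → P x ∧ not (x ≡ᵇ a)))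
  count-remove n {P} {a} a<n Pa = begin
    count n P                                         ≡⟨ count-split n P (_≡ᵇ a) ⟩
    count n (λ x → P x ∧ (x ≡ᵇ a)) + others           ≡⟨ cong (_+ others) (∑-cong n (λ x _ → cong 𝟙 (is-a x))) ⟩
    count n (_≡ᵇ a) + others                          ≡⟨ cong (_+ others) (count-≡ᵇ n a<n) ⟩
    suc others                                        ∎
    where
    open ≡-Reasoning
    others : ℕ
    others = count n (λ x → P x ∧ not (x ≡ᵇ a))
    is-a : ∀ x → P x ∧ (x ≡ᵇ a) ≡ (x ≡ᵇ a)
    is-a x with x ≟ a
    ... | yes refl rewrite ≡ᵇ-refl x = trans (∧-identityʳ (P x)) Pa
    ... | no x≢a rewrite ≡ᵇ-false⁺ x≢a = ∧-zeroʳ (P x)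

  count-≥-except : ∀ s {i a} → i ≤ a → a < s → count s (λ b → (i ≤ᵇ b) ∧ not (b ≡ᵇ a)) ≡ s ∸ i ∸ 1
  count-≥-except s {i} i≤a a<s =
    trans (sym (cong (_∸ 1) (count-remove s {i ≤ᵇ_} a<s (≤ᵇ-true⁺ i≤a)))) (cong (_∸ 1) (count-≥ s i))

  count-interval : ∀ s {i m} → i ≤ m → m ≤ s → count s (λ a → (i ≤ᵇ a) ∧ (a <ᵇ m)) ≡ m ∸ i
  count-interval s {i} {m} i≤m m≤s = +-cancelʳ-≡ (s ∸ m) _ _ (begin
    inside + (s ∸ m)                                          ≡⟨ cong (inside +_) (count-≥ s m) ⟨
    inside + count s (m ≤ᵇ_)                                  ≡⟨ cong (inside +_) (∑-cong s (λ a _ → cong 𝟙 (above-m a))) ⟩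
    inside + count s (λ a → (i ≤ᵇ a) ∧ not (a <ᵇ m))          ≡⟨ count-split s (i ≤ᵇ_) (_<ᵇ m) ⟨
    count s (i ≤ᵇ_)                                           ≡⟨ count-≥ s i ⟩
    s ∸ i                                                     ≡⟨ cong (_∸ i) (m+[n∸m]≡n m≤s) ⟨
    m + (s ∸ m) ∸ i                                           ≡⟨ +-∸-comm (s ∸ m) i≤m ⟩
    m ∸ i + (s ∸ m)                                           ∎)
    where
    open ≡-Reasoning
    inside : ℕ
    inside = count s (λ a → (i ≤ᵇ a) ∧ (a <ᵇ m))
    above-m : ∀ a → (m ≤ᵇ a) ≡ ((i ≤ᵇ a) ∧ not (a <ᵇ m))
    above-m a with a <? m
    ... | yes a<m rewrite <ᵇ-true⁺ a<m | ≤ᵇ-false⁺ (<⇒≱ a<m) | ∧-zeroʳ (i ≤ᵇ a) = refl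
    ... | no a≮m rewrite <ᵇ-false⁺ a≮m | ≤ᵇ-true⁺ (≮⇒≥ a≮m) | ≤ᵇ-true⁺ (≤-trans i≤m (≮⇒≥ a≮m)) = refl

  ∑-𝟙-* : ∀ n (P : ℕ → Bool) c → ∑[ x < n ] (𝟙 (P x) * c) ≡ count n P * c
  ∑-𝟙-* n P c = begin
    ∑[ x < n ] (𝟙 (P x) * c)  ≡⟨ ∑-cong n (λ x _ → *-comm (𝟙 (P x)) c) ⟩
    ∑[ x < n ] (c * 𝟙 (P x))  ≡⟨ ∑-*ˡ n c (λ x → 𝟙 (P x)) ⟩
    c * count n P              ≡⟨ *-comm c (count n P) ⟩
    count n P * c              ∎
    where open ≡-Reasoning

  collect : (ℕ → Bool) → (ℕ → ℕ) → ℕ → List ℕ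
  collect P f zero = []
  collect P f (suc n) = if P n then f n ∷ collect P f n else collect P f n

  length-collect : ∀ P f n → length (collect P f n) ≡ count n P
  length-collect P f zero = refl
  length-collect P f (suc n) with P n
  ... | true = trans (cong suc (length-collect P f n)) (+-comm 1 _)
  ... | false = trans (length-collect P f n) (sym (+-identityʳ _))

  collect⁺ : ∀ {Q : ℕ → Set} P f n → (∀ x → x < n → P x ≡ true → Q (f x)) → All Q (collect P f n)
  collect⁺ P f zero _ = []
  collect⁺ P f (suc n) Q-of with P n in Pn
  ... | true = Q-of n ≤-refl Pn ∷ collect⁺ P f n (λ x x<n → Q-of x (m<n⇒m<1+n x<n))
  ... | false = collect⁺ P f n (λ x x<n → Q-of x (m<n⇒m<1+n x<n))

  collect⁻ : ∀ {Q : ℕ → Set} P f n → All Q (collect P f n) → ∀ x → x < n → P x ≡ true → Q (f x)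
  collect⁻ P f (suc n) all x x<1+n Px with P n in Pn | <suc-cases x<1+n
  ... | true | inj₂ refl = All.head all
  ... | true | inj₁ x<n = collect⁻ P f n (All.tail all) x x<n Px
  ... | false | inj₁ x<n = collect⁻ P f n all x x<n Px
  ... | false | inj₂ refl = ⊥-elim (true≢false (trans (sym Px) Pn))

module Enumeration where

  open import Data.Nat
  open import Data.Nat.Properties
  open import Data.Bool using (Bool; true; false; if_then_else_)
  open import Data.Product using (∃; _×_; _,_)
  open import Data.Sum using (inj₁; inj₂)
  open import Data.Empty using (⊥-elim)
  open import Relation.Binary.Definitions using (tri<; tri≈; tri>)
  open import Relation.Binary.PropositionalEquality
  open Counting

  record Enumeration (N : ℕ) (V : ℕ → Bool) : Set where
    field
      size : ℕ
      at : ℕ → ℕ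
      at-< : ∀ a → a < size → at a < N
      at-∈ : ∀ a → a < size → V (at a) ≡ true
      at-strictMono : ∀ a b → a < b → b < size → at a < at b
      at-onto : ∀ u → u < N → V u ≡ true → ∃ λ a → a < size × at a ≡ u
      ∑-reindex : ∀ (g : ℕ → ℕ) → ∑[ u < N ] (if V u then g u else 0) ≡ ∑[ a < size ] g (at a)

    at-injective : ∀ a b → a < size → b < size → at a ≡ at b → a ≡ b
    at-injective a b a<s b<s at-a≡at-b with <-cmp a b
    ... | tri< a<b _ _ = ⊥-elim (<-irrefl at-a≡at-b (at-strictMono a b a<b b<s))
    ... | tri≈ _ a≡b _ = a≡b
    ... | tri> _ _ b<a = ⊥-elim (<-irrefl (sym at-a≡at-b) (at-strictMono b a b<a a<s))

    size≡count : size ≡ count N V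
    size≡count = sym (begin
      count N V                                ≡⟨ ∑-cong N (λ u _ → 𝟙-as-if (V u)) ⟩
      ∑[ u < N ] (if V u then 1 else 0)        ≡⟨ ∑-reindex (λ _ → 1) ⟩
      ∑[ a < size ] 1                          ≡⟨ ∑-const size 1 ⟩
      size * 1                                 ≡⟨ *-identityʳ size ⟩
      size                                     ∎)
      where
      open ≡-Reasoning
      𝟙-as-if : ∀ b → 𝟙 b ≡ (if b then 1 else 0)
      𝟙-as-if true = refl
      𝟙-as-if false = refl

  enumerate : ∀ N V → Enumeration N V
  enumerate zero V = record
    { size = 0 ; at = λ _ → 0 ; at-< = λ _ () ; at-∈ = λ _ () ; at-strictMono = λ _ _ _ ()
    ; at-onto = λ _ () ; ∑-reindex = λ _ → refl }
  enumerate (suc n) V with V n in Vn | enumerate n V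
  ... | false | E = record
    { size = size ; at = at ; at-< = λ a a<s → m<n⇒m<1+n (at-< a a<s) ; at-∈ = at-∈
    ; at-strictMono = at-strictMono ; at-onto = onto ; ∑-reindex = reindex }
    where
    open Enumeration E
    onto : ∀ u → u < suc n → V u ≡ true → ∃ λ a → a < size × at a ≡ u
    onto u u<1+n Vu with m≤n⇒m<n∨m≡n (s≤s⁻¹ u<1+n)
    ... | inj₁ u<n = at-onto u u<n Vu
    ... | inj₂ refl = ⊥-elim (true≢false (trans (sym Vu) Vn))
    reindex : ∀ (g : ℕ → ℕ) → ∑[ u < suc n ] (if V u then g u else 0) ≡ ∑[ a < size ] g (at a)
    reindex g rewrite Vn = trans (+-identityʳ _) (∑-reindex g)
  ... | true | E = record
    { size = suc size ; at = at′ ; at-< = at′-< ; at-∈ = at′-∈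
    ; at-strictMono = at′-strictMono ; at-onto = onto ; ∑-reindex = reindex }
    where
    open Enumeration E
    at′ : ℕ → ℕ
    at′ a = if a <ᵇ size then at a else n
    at′-old : ∀ {a} → a < size → at′ a ≡ at a
    at′-old a<s rewrite <ᵇ-true⁺ a<s = refl
    at′-new : at′ size ≡ n
    at′-new rewrite <ᵇ-false⁺ (<-irrefl {size} refl) = refl
    at′-< : ∀ a → a < suc size → at′ a < suc n
    at′-< a a<1+s with m≤n⇒m<n∨m≡n (s≤s⁻¹ a<1+s)
    ... | inj₁ a<s rewrite at′-old a<s = m<n⇒m<1+n (at-< a a<s)
    ... | inj₂ refl rewrite at′-new = ≤-refl
    at′-∈ : ∀ a → a < suc size → V (at′ a) ≡ true
    at′-∈ a a<1+s with m≤n⇒m<n∨m≡n (s≤s⁻¹ a<1+s)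
    ... | inj₁ a<s rewrite at′-old a<s = at-∈ a a<s
    ... | inj₂ refl rewrite at′-new = Vn
    at′-strictMono : ∀ a b → a < b → b < suc size → at′ a < at′ b
    at′-strictMono a b a<b b<1+s with m≤n⇒m<n∨m≡n (s≤s⁻¹ b<1+s)
    ... | inj₁ b<s rewrite at′-old (<-trans a<b b<s) | at′-old b<s = at-strictMono a b a<b b<s
    ... | inj₂ refl rewrite at′-old a<b | at′-new = at-< a a<b
    onto : ∀ u → u < suc n → V u ≡ true → ∃ λ a → a < suc size × at′ a ≡ u
    onto u u<1+n Vu with m≤n⇒m<n∨m≡n (s≤s⁻¹ u<1+n)
    ... | inj₁ u<n = let (a , a<s , at-a≡u) = at-onto u u<n Vu in a , m<n⇒m<1+n a<s , trans (at′-old a<s) at-a≡u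
    ... | inj₂ refl = size , ≤-refl , at′-new
    reindex : ∀ (g : ℕ → ℕ) → ∑[ u < suc n ] (if V u then g u else 0) ≡ ∑[ a < suc size ] g (at′ a)
    reindex g rewrite Vn = cong₂ _+_
      (trans (∑-reindex g) (∑-cong size (λ a a<s → cong g (sym (at′-old a<s)))))
      (cong g (sym at′-new))

module ErdosGallai where

  open import Data.Nat
  open import Data.Nat.Properties
  open import Data.Bool using (Bool; true; false; _∧_; _∨_; not; if_then_else_)
  open import Data.Bool.Properties using (∧-zeroʳ; ∨-zeroʳ; ¬-not) renaming (_≟_ to _≟ᵇ_)
  open import Data.Product using (∃; _×_; _,_; proj₁; proj₂)
  open import Data.Sum using (_⊎_; inj₁; inj₂; [_,_]′)
  open import Data.Empty using (⊥-elim)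
  open import Relation.Nullary using (¬_; Dec; yes; no)
  open import Relation.Nullary.Decidable using (_×-dec_; _⊎-dec_; ¬?)
  open import Relation.Binary.Definitions using (tri<; tri≈; tri>)
  open import Relation.Binary.PropositionalEquality
  open import Data.Nat.Tactic.RingSolver using (solve-∀)
  open Counting

  Graph : Set
  Graph = ℕ → ℕ → Bool

  Symmetric : Graph → Set
  Symmetric E = ∀ a b → E a b ≡ E b a

  Irreflexive : Graph → Set
  Irreflexive E = ∀ a → E a a ≡ false

  nonNeighbours : ℕ → Graph → ℕ → ℕ
  nonNeighbours s E a = count s (λ b → not (a ≡ᵇ b) ∧ not (E a b))

  nonEdges : ℕ → Graph → ℕ
  nonEdges s E = ∑[ a < s ] nonNeighbours s E a

  record Matching (s k : ℕ) (E : Graph) : Set where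
    field
      left right : ℕ → ℕ
      left-< : ∀ l → l < k → left l < s
      right-< : ∀ l → l < k → right l < s
      edge : ∀ l → l < k → E (left l) (right l) ≡ true
      left-injective : ∀ l l′ → l < k → l′ < k → left l ≡ left l′ → l ≡ l′
      right-injective : ∀ l l′ → l < k → l′ < k → right l ≡ right l′ → l ≡ l′
      left≢right : ∀ l l′ → l < k → l′ < k → left l ≢ right l′

    matched : ℕ → Bool
    matched a = any< k (λ l → (left l ≡ᵇ a) ∨ (right l ≡ᵇ a))

    2k≤#matched : k + k ≤ count s matched
    2k≤#matched = subst (_≤ count s matched) (count-true (k + k))
      (count-injection (k + k) s endpoint endpoint-matched endpoint-injective)
      where
      endpoint : ℕ → ℕ
      endpoint x = if x <ᵇ k then left x else right (x ∸ k)
      second-half : ∀ {x} → ¬ x < k → x < k + k → x ∸ k < k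
      second-half x≮k x<2k = +-cancelˡ-< k _ _ (subst (_< k + k) (sym (m+[n∸m]≡n (≮⇒≥ x≮k))) x<2k)
      endpoint-matched : ∀ x → x < k + k → true ≡ true → endpoint x < s × matched (endpoint x) ≡ true
      endpoint-matched x x<2k _ with x <? k
      ... | yes x<k rewrite <ᵇ-true⁺ x<k =
        left-< x x<k , any<-true⁺ k x x<k (cong (_∨ (right x ≡ᵇ left x)) (≡ᵇ-refl (left x)))
      ... | no x≮k rewrite <ᵇ-false⁺ x≮k = let l<k = second-half x≮k x<2k in
        right-< (x ∸ k) l<k ,
        any<-true⁺ k (x ∸ k) l<k (trans (cong ((left (x ∸ k) ≡ᵇ right (x ∸ k)) ∨_) (≡ᵇ-refl (right (x ∸ k))))
                                        (∨-zeroʳ _))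
      endpoint-injective : ∀ x y → x < k + k → y < k + k → true ≡ true → true ≡ true → endpoint x ≡ endpoint y → x ≡ y
      endpoint-injective x y x<2k y<2k _ _ eq with x <? k | y <? k
      ... | yes x<k | yes y<k rewrite <ᵇ-true⁺ x<k | <ᵇ-true⁺ y<k = left-injective x y x<k y<k eq
      ... | yes x<k | no y≮k rewrite <ᵇ-true⁺ x<k | <ᵇ-false⁺ y≮k =
        ⊥-elim (left≢right x (y ∸ k) x<k (second-half y≮k y<2k) eq)
      ... | no x≮k | yes y<k rewrite <ᵇ-false⁺ x≮k | <ᵇ-true⁺ y<k =
        ⊥-elim (left≢right y (x ∸ k) y<k (second-half x≮k x<2k) (sym eq))
      ... | no x≮k | no y≮k rewrite <ᵇ-false⁺ x≮k | <ᵇ-false⁺ y≮k = begin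
        x               ≡⟨ m+[n∸m]≡n (≮⇒≥ x≮k) ⟨
        k + (x ∸ k)     ≡⟨ cong (k +_) (right-injective (x ∸ k) (y ∸ k) (second-half x≮k x<2k) (second-half y≮k y<2k) eq) ⟩
        k + (y ∸ k)     ≡⟨ m+[n∸m]≡n (≮⇒≥ y≮k) ⟩
        y               ∎
        where open ≡-Reasoning

  -- Outside {i, j}, vertex i receives the union and j the intersection of their neighbourhoods.
  shift : ℕ → ℕ → Graph → Graph
  shift i j E a b =
    if a ≡ᵇ i then (if (b ≡ᵇ i) ∨ (b ≡ᵇ j) then E a b else E i b ∨ E j b)
    else if a ≡ᵇ j then (if (b ≡ᵇ i) ∨ (b ≡ᵇ j) then E a b else E j b ∧ E i b)
    else if b ≡ᵇ i then E a i ∨ E a j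
    else if b ≡ᵇ j then E a j ∧ E a i
    else E a b

  data Position (i j x : ℕ) : Set where
    at-i : x ≡ i → Position i j x
    at-j : x ≡ j → x ≢ i → Position i j x
    elsewhere : x ≢ i → x ≢ j → Position i j x

  position : ∀ i j x → Position i j x
  position i j x with x ≟ i | x ≟ j
  ... | yes x≡i | _ = at-i x≡i
  ... | no x≢i | yes x≡j = at-j x≡j x≢i
  ... | no x≢i | no x≢j = elsewhere x≢i x≢j

  swap : ℕ → ℕ → ℕ → ℕ
  swap i j x = if x ≡ᵇ i then j else if x ≡ᵇ j then i else x

  rowWeight : ℕ → Graph → ℕ → ℕ
  rowWeight s E a = ∑[ b < s ] (𝟙 (E a b) * (a + b))

  weight : ℕ → Graph → ℕ
  weight s E = ∑[ a < s ] rowWeight s E a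

  private
    𝟙-not-∨-∧ : ∀ x y → 𝟙 (not (x ∨ y)) + 𝟙 (not (y ∧ x)) ≡ 𝟙 (not x) + 𝟙 (not y)
    𝟙-not-∨-∧ true true = refl
    𝟙-not-∨-∧ true false = refl
    𝟙-not-∨-∧ false true = refl
    𝟙-not-∨-∧ false false = refl

    𝟙-∨-∧-weighted : ∀ x y {c d} → c ≤ d → 𝟙 (x ∨ y) * c + 𝟙 (y ∧ x) * d ≤ 𝟙 x * c + 𝟙 y * d
    𝟙-∨-∧-weighted true true c≤d = ≤-refl
    𝟙-∨-∧-weighted true false c≤d = ≤-refl
    𝟙-∨-∧-weighted false true {c} {d} c≤d = subst₂ _≤_ (sym (trans (+-identityʳ (c + 0)) (+-identityʳ c))) (sym (+-identityʳ d)) c≤d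
    𝟙-∨-∧-weighted false false c≤d = ≤-refl

  module _ {i j : ℕ} (E : Graph) (i≢j : i ≢ j) where

    private
      j≢i : j ≢ i
      j≢i = ≢-sym i≢j

    shift-ii : shift i j E i i ≡ E i i
    shift-ii rewrite ≡ᵇ-refl i = refl

    shift-ij : shift i j E i j ≡ E i j
    shift-ij rewrite ≡ᵇ-refl i | ≡ᵇ-refl j with j ≡ᵇ i
    ... | true = refl
    ... | false = refl

    shift-ji : shift i j E j i ≡ E j i
    shift-ji rewrite ≡ᵇ-false⁺ j≢i | ≡ᵇ-refl j | ≡ᵇ-refl i = refl

    shift-jj : shift i j E j j ≡ E j j
    shift-jj rewrite ≡ᵇ-false⁺ j≢i | ≡ᵇ-refl j = refl

    shift-ix : ∀ {x} → x ≢ i → x ≢ j → shift i j E i x ≡ E i x ∨ E j x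
    shift-ix x≢i x≢j rewrite ≡ᵇ-refl i | ≡ᵇ-false⁺ x≢i | ≡ᵇ-false⁺ x≢j = refl

    shift-jx : ∀ {x} → x ≢ i → x ≢ j → shift i j E j x ≡ E j x ∧ E i x
    shift-jx x≢i x≢j rewrite ≡ᵇ-false⁺ j≢i | ≡ᵇ-refl j | ≡ᵇ-false⁺ x≢i | ≡ᵇ-false⁺ x≢j = refl

    shift-xi : ∀ {x} → x ≢ i → x ≢ j → shift i j E x i ≡ E x i ∨ E x j
    shift-xi x≢i x≢j rewrite ≡ᵇ-false⁺ x≢i | ≡ᵇ-false⁺ x≢j | ≡ᵇ-refl i = refl

    shift-xj : ∀ {x} → x ≢ i → x ≢ j → shift i j E x j ≡ E x j ∧ E x i
    shift-xj x≢i x≢j rewrite ≡ᵇ-false⁺ x≢i | ≡ᵇ-false⁺ x≢j | ≡ᵇ-false⁺ j≢i | ≡ᵇ-refl j = refl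

    shift-xy : ∀ {x y} → x ≢ i → x ≢ j → y ≢ i → y ≢ j → shift i j E x y ≡ E x y
    shift-xy x≢i x≢j y≢i y≢j rewrite ≡ᵇ-false⁺ x≢i | ≡ᵇ-false⁺ x≢j | ≡ᵇ-false⁺ y≢i | ≡ᵇ-false⁺ y≢j = refl

    shift-symmetric : Symmetric E → Symmetric (shift i j E)
    shift-symmetric E-sym a b with position i j a | position i j b
    ... | at-i refl | at-i refl = refl
    ... | at-i refl | at-j refl _ = trans shift-ij (trans (E-sym i j) (sym shift-ji))
    ... | at-i refl | elsewhere b≢i b≢j =
      trans (shift-ix b≢i b≢j) (trans (cong₂ _∨_ (E-sym i b) (E-sym j b)) (sym (shift-xi b≢i b≢j)))
    ... | at-j refl _ | at-i refl = trans shift-ji (trans (E-sym j i) (sym shift-ij))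
    ... | at-j refl _ | at-j refl _ = refl
    ... | at-j refl _ | elsewhere b≢i b≢j =
      trans (shift-jx b≢i b≢j) (trans (cong₂ _∧_ (E-sym j b) (E-sym i b)) (sym (shift-xj b≢i b≢j)))
    ... | elsewhere a≢i a≢j | at-i refl =
      trans (shift-xi a≢i a≢j) (trans (cong₂ _∨_ (E-sym a i) (E-sym a j)) (sym (shift-ix a≢i a≢j)))
    ... | elsewhere a≢i a≢j | at-j refl _ =
      trans (shift-xj a≢i a≢j) (trans (cong₂ _∧_ (E-sym a j) (E-sym a i)) (sym (shift-jx a≢i a≢j)))
    ... | elsewhere a≢i a≢j | elsewhere b≢i b≢j =
      trans (shift-xy a≢i a≢j b≢i b≢j) (trans (E-sym a b) (sym (shift-xy b≢i b≢j a≢i a≢j)))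

    shift-irreflexive : Irreflexive E → Irreflexive (shift i j E)
    shift-irreflexive E-irr a with position i j a
    ... | at-i refl = trans shift-ii (E-irr i)
    ... | at-j refl _ = trans shift-jj (E-irr j)
    ... | elsewhere a≢i a≢j = trans (shift-xy a≢i a≢j a≢i a≢j) (E-irr a)

    swap-i : swap i j i ≡ j
    swap-i rewrite ≡ᵇ-refl i = refl

    swap-j : swap i j j ≡ i
    swap-j rewrite ≡ᵇ-false⁺ j≢i | ≡ᵇ-refl j = refl

    swap-x : ∀ {x} → x ≢ i → x ≢ j → swap i j x ≡ x
    swap-x x≢i x≢j rewrite ≡ᵇ-false⁺ x≢i | ≡ᵇ-false⁺ x≢j = refl

    swap-involutive : ∀ x → swap i j (swap i j x) ≡ x
    swap-involutive x with position i j x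
    ... | at-i refl = trans (cong (swap i j) swap-i) swap-j
    ... | at-j refl _ = trans (cong (swap i j) swap-j) swap-i
    ... | elsewhere x≢i x≢j = trans (cong (swap i j) (swap-x x≢i x≢j)) (swap-x x≢i x≢j)

    swap-injective : ∀ {x y} → swap i j x ≡ swap i j y → x ≡ y
    swap-injective {x} {y} eq = trans (sym (swap-involutive x)) (trans (cong (swap i j) eq) (swap-involutive y))

    swap-< : ∀ {s x} → i < s → j < s → x < s → swap i j x < s
    swap-< {s} {x} i<s j<s x<s with position i j x
    ... | at-i refl = subst (_< s) (sym swap-i) j<s
    ... | at-j refl _ = subst (_< s) (sym swap-j) i<s
    ... | elsewhere x≢i x≢j = subst (_< s) (sym (swap-x x≢i x≢j)) x<s

    shift-edge⇒edge : Symmetric E → ∀ a b → shift i j E a b ≡ true → a ≢ b →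
                      (a ≡ i → E i b ≡ true) → (b ≡ i → E i a ≡ true) → E a b ≡ true
    shift-edge⇒edge E-sym a b shifted a≢b a≡i⇒ b≡i⇒ with position i j a | position i j b
    ... | at-i refl | at-i refl = ⊥-elim (a≢b refl)
    ... | at-i refl | at-j refl _ = trans (sym shift-ij) shifted
    ... | at-i refl | elsewhere _ _ = a≡i⇒ refl
    ... | at-j refl _ | at-i refl = trans (sym shift-ji) shifted
    ... | at-j refl _ | at-j refl _ = ⊥-elim (a≢b refl)
    ... | at-j refl _ | elsewhere b≢i b≢j = proj₁ (∧-true⁻ (trans (sym (shift-jx b≢i b≢j)) shifted))
    ... | elsewhere _ _ | at-i refl = trans (E-sym a i) (b≡i⇒ refl)
    ... | elsewhere a≢i a≢j | at-j refl _ = proj₁ (∧-true⁻ (trans (sym (shift-xj a≢i a≢j)) shifted))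
    ... | elsewhere a≢i a≢j | elsewhere b≢i b≢j = trans (sym (shift-xy a≢i a≢j b≢i b≢j)) shifted

    shift-edge⇒swapped-edge : ∀ a b → shift i j E a b ≡ true → a ≢ i → b ≢ i → a ≢ b →
                              E (swap i j a) (swap i j b) ≡ true
    shift-edge⇒swapped-edge a b shifted a≢i b≢i a≢b with position i j a | position i j b
    ... | at-i a≡i | _ = ⊥-elim (a≢i a≡i)
    ... | _ | at-i b≡i = ⊥-elim (b≢i b≡i)
    ... | at-j refl _ | at-j refl _ = ⊥-elim (a≢b refl)
    ... | at-j refl _ | elsewhere b≢i b≢j rewrite swap-j | swap-x b≢i b≢j =
      proj₂ (∧-true⁻ (trans (sym (shift-jx b≢i b≢j)) shifted))
    ... | elsewhere a≢i a≢j | at-j refl _ rewrite swap-j | swap-x a≢i a≢j =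
      proj₂ (∧-true⁻ (trans (sym (shift-xj a≢i a≢j)) shifted))
    ... | elsewhere a≢i a≢j | elsewhere b≢i b≢j rewrite swap-x a≢i a≢j | swap-x b≢i b≢j =
      trans (sym (shift-xy a≢i a≢j b≢i b≢j)) shifted

    shift-edge-at-i : ∀ x → shift i j E i x ≡ true → E i x ≡ false → x ≢ i → E j x ≡ true × x ≢ j
    shift-edge-at-i x shifted ¬Eix x≢i with position i j x
    ... | at-i x≡i = ⊥-elim (x≢i x≡i)
    ... | at-j refl _ = ⊥-elim (true≢false (trans (sym shifted) (trans shift-ij ¬Eix)))
    ... | elsewhere x≢i x≢j with ∨-true⁻ (trans (sym (shift-ix x≢i x≢j)) shifted)
    ...   | inj₁ Eix = ⊥-elim (true≢false (trans (sym Eix) ¬Eix))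
    ...   | inj₂ Ejx = Ejx , x≢j

    module _ (E-sym : Symmetric E) {s k : ℕ} (i<s : i < s) (j<s : j < s) (M : Matching s k (shift i j E)) where
      open Matching M

      private
        swapped-matching : ∀ l₀ → (∀ l → l < k → l ≢ l₀ → left l ≢ i × right l ≢ i) →
                           E (swap i j (left l₀)) (swap i j (right l₀)) ≡ true → Matching s k E
        swapped-matching l₀ avoid-i edge-l₀ = record
          { left = λ l → swap i j (left l)
          ; right = λ l → swap i j (right l)
          ; left-< = λ l l<k → swap-< i<s j<s (left-< l l<k)
          ; right-< = λ l l<k → swap-< i<s j<s (right-< l l<k)
          ; edge = edge′
          ; left-injective = λ l l′ l<k l′<k eq → left-injective l l′ l<k l′<k (swap-injective eq)
          ; right-injective = λ l l′ l<k l′<k eq → right-injective l l′ l<k l′<k (swap-injective eq)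
          ; left≢right = λ l l′ l<k l′<k eq → left≢right l l′ l<k l′<k (swap-injective eq) }
          where
          edge′ : ∀ l → l < k → E (swap i j (left l)) (swap i j (right l)) ≡ true
          edge′ l l<k with l ≟ l₀
          ... | yes refl = edge-l₀
          ... | no l≢l₀ = let (left≢i , right≢i) = avoid-i l l<k l≢l₀ in
            shift-edge⇒swapped-edge (left l) (right l) (edge l l<k) left≢i right≢i (left≢right l l l<k l<k)

        LostAt : ℕ → Set
        LostAt l = (left l ≡ i × E i (right l) ≡ false) ⊎ (right l ≡ i × E i (left l) ≡ false)

        from-lost : ∃ (λ l → l < k × LostAt l) → Matching s k E
        from-lost (l₀ , l₀<k , inj₁ (left≡i , ¬Eix)) = swapped-matching l₀ avoid-i edge-l₀
          where
          x : ℕ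
          x = right l₀
          x-edge : shift i j E i x ≡ true
          x-edge = subst (λ z → shift i j E z x ≡ true) left≡i (edge l₀ l₀<k)
          x≢i : x ≢ i
          x≢i x≡i = left≢right l₀ l₀ l₀<k l₀<k (trans left≡i (sym x≡i))
          avoid-i : ∀ l → l < k → l ≢ l₀ → left l ≢ i × right l ≢ i
          avoid-i l l<k l≢l₀ = (λ eq → l≢l₀ (left-injective l l₀ l<k l₀<k (trans eq (sym left≡i))))
                             , (λ eq → left≢right l₀ l l₀<k l<k (trans left≡i (sym eq)))
          edge-l₀ : E (swap i j (left l₀)) (swap i j x) ≡ true
          edge-l₀ with shift-edge-at-i x x-edge ¬Eix x≢i
          ... | Ejx , x≢j rewrite left≡i | swap-i | swap-x x≢i x≢j = Ejx
        from-lost (l₀ , l₀<k , inj₂ (right≡i , ¬Eix)) = swapped-matching l₀ avoid-i edge-l₀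
          where
          x : ℕ
          x = left l₀
          x-edge : shift i j E i x ≡ true
          x-edge = trans (shift-symmetric E-sym i x) (subst (λ z → shift i j E x z ≡ true) right≡i (edge l₀ l₀<k))
          x≢i : x ≢ i
          x≢i x≡i = left≢right l₀ l₀ l₀<k l₀<k (trans x≡i (sym right≡i))
          avoid-i : ∀ l → l < k → l ≢ l₀ → left l ≢ i × right l ≢ i
          avoid-i l l<k l≢l₀ = (λ eq → left≢right l l₀ l<k l₀<k (trans eq (sym right≡i)))
                             , (λ eq → l≢l₀ (right-injective l l₀ l<k l₀<k (trans eq (sym right≡i))))
          edge-l₀ : E (swap i j x) (swap i j (right l₀)) ≡ true
          edge-l₀ with shift-edge-at-i x x-edge ¬Eix x≢i
          ... | Ejx , x≢j rewrite right≡i | swap-i | swap-x x≢i x≢j = trans (E-sym x j) Ejx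

        unchanged : ¬ ∃ (λ l → l < k × LostAt l) → Matching s k E
        unchanged none = record
          { left = left ; right = right ; left-< = left-< ; right-< = right-<
          ; edge = λ l l<k → shift-edge⇒edge E-sym (left l) (right l) (edge l l<k) (left≢right l l l<k l<k)
              (λ left≡i → ¬-not λ Eix≡false → none (l , l<k , inj₁ (left≡i , Eix≡false)))
              (λ right≡i → ¬-not λ Eix≡false → none (l , l<k , inj₂ (right≡i , Eix≡false)))
          ; left-injective = left-injective ; right-injective = right-injective ; left≢right = left≢right }

      -- A lost edge can only sit at i, which the matching uses once; swapping i and j repairs it.
      unshift-matching : Matching s k E
      unshift-matching with anyUpTo? (λ l → (left l ≟ i ×-dec E i (right l) ≟ᵇ false)
                                            ⊎-dec (right l ≟ i ×-dec E i (left l) ≟ᵇ false)) k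
      ... | yes lost = from-lost lost
      ... | no none = unchanged none

    nonEdges-shift : ∀ {s} → i < s → j < s → nonEdges s (shift i j E) ≡ nonEdges s E
    nonEdges-shift {s} i<s j<s = ∑-cong-pair s i<s j<s i≢j other-rows rows-i-j
      where
      columns-i-j : ∀ {a} → a ≢ i → a ≢ j →
        𝟙 (not (a ≡ᵇ i) ∧ not (shift i j E a i)) + 𝟙 (not (a ≡ᵇ j) ∧ not (shift i j E a j)) ≡
        𝟙 (not (a ≡ᵇ i) ∧ not (E a i)) + 𝟙 (not (a ≡ᵇ j) ∧ not (E a j))
      columns-i-j {a} a≢i a≢j rewrite shift-xi a≢i a≢j | shift-xj a≢i a≢j | ≡ᵇ-false⁺ a≢i | ≡ᵇ-false⁺ a≢j =
        𝟙-not-∨-∧ (E a i) (E a j)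
      other-rows : ∀ a → a < s → a ≢ i → a ≢ j → nonNeighbours s (shift i j E) a ≡ nonNeighbours s E a
      other-rows a _ a≢i a≢j = ∑-cong-pair s i<s j<s i≢j
        (λ b _ b≢i b≢j → cong (λ z → 𝟙 (not (a ≡ᵇ b) ∧ not z)) (shift-xy a≢i a≢j b≢i b≢j))
        (columns-i-j a≢i a≢j)
      entries-i-j : ∀ b →
        𝟙 (not (i ≡ᵇ b) ∧ not (shift i j E i b)) + 𝟙 (not (j ≡ᵇ b) ∧ not (shift i j E j b)) ≡
        𝟙 (not (i ≡ᵇ b) ∧ not (E i b)) + 𝟙 (not (j ≡ᵇ b) ∧ not (E j b))
      entries-i-j b with position i j b
      ... | at-i refl rewrite shift-ii | shift-ji = refl
      ... | at-j refl _ rewrite shift-ij | shift-jj = refl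
      ... | elsewhere b≢i b≢j rewrite shift-ix b≢i b≢j | shift-jx b≢i b≢j
                                    | ≡ᵇ-false⁺ (≢-sym b≢i) | ≡ᵇ-false⁺ (≢-sym b≢j) = 𝟙-not-∨-∧ (E i b) (E j b)
      rows-i-j : nonNeighbours s (shift i j E) i + nonNeighbours s (shift i j E) j ≡ nonNeighbours s E i + nonNeighbours s E j
      rows-i-j = trans (sym (∑-distrib-+ s _ _)) (trans (∑-cong s (λ b _ → entries-i-j b)) (∑-distrib-+ s _ _))

    weight-shift-< : ∀ {s x} → i < j → j < s → x < s → x ≢ i → x ≢ j → E j x ≡ true → E i x ≡ false →
                     weight s (shift i j E) < weight s E
    weight-shift-< {s} {x} i<j j<s x<s x≢i x≢j Ejx ¬Eix = ∑-mono-<-pair s i<s j<s i≢j other-rows rows-i-j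
      where
      i<s : i < s
      i<s = <-trans i<j j<s
      other-rows : ∀ a → a < s → a ≢ i → a ≢ j → rowWeight s (shift i j E) a ≤ rowWeight s E a
      other-rows a _ a≢i a≢j = ∑-mono-≤-pair s i<s j<s i≢j
        (λ b _ b≢i b≢j → ≤-reflexive (cong (λ z → 𝟙 z * (a + b)) (shift-xy a≢i a≢j b≢i b≢j)))
        (subst (_≤ 𝟙 (E a i) * (a + i) + 𝟙 (E a j) * (a + j))
          (sym (cong₂ (λ u v → 𝟙 u * (a + i) + 𝟙 v * (a + j)) (shift-xi a≢i a≢j) (shift-xj a≢i a≢j)))
          (𝟙-∨-∧-weighted (E a i) (E a j) (+-monoʳ-≤ a (<⇒≤ i<j))))
      entries-i-j : ∀ b → 𝟙 (shift i j E i b) * (i + b) + 𝟙 (shift i j E j b) * (j + b) ≤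
                          𝟙 (E i b) * (i + b) + 𝟙 (E j b) * (j + b)
      entries-i-j b with position i j b
      ... | at-i refl rewrite shift-ii | shift-ji = ≤-refl
      ... | at-j refl _ rewrite shift-ij | shift-jj = ≤-refl
      ... | elsewhere b≢i b≢j rewrite shift-ix b≢i b≢j | shift-jx b≢i b≢j =
        𝟙-∨-∧-weighted (E i b) (E j b) (+-monoˡ-≤ b (<⇒≤ i<j))
      entry-x : 𝟙 (shift i j E i x) * (i + x) + 𝟙 (shift i j E j x) * (j + x) <
                𝟙 (E i x) * (i + x) + 𝟙 (E j x) * (j + x)
      entry-x rewrite shift-ix x≢i x≢j | shift-jx x≢i x≢j | Ejx | ¬Eix =
        subst₂ _<_ (sym (trans (+-identityʳ _) (+-identityʳ _))) (sym (+-identityʳ _)) (+-monoˡ-< x i<j)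
      rows-i-j : rowWeight s (shift i j E) i + rowWeight s (shift i j E) j < rowWeight s E i + rowWeight s E j
      rows-i-j = subst₂ _<_ (∑-distrib-+ s _ _) (∑-distrib-+ s _ _) (∑-mono-< s x<s (λ b _ → entries-i-j b) entry-x)

  Shifted : ℕ → Graph → Set
  Shifted s E = ∀ i j x → i < j → j < s → x < s → x ≢ i → x ≢ j → E j x ≡ true → E i x ≡ true

  record ShiftedVersion (s : ℕ) (E : Graph) : Set where
    field
      graph : Graph
      symmetric : Symmetric graph
      irreflexive : Irreflexive graph
      shifted : Shifted s graph
      nonEdges-≡ : nonEdges s graph ≡ nonEdges s E
      matching⇒ : ∀ {k} → Matching s k graph → Matching s k E

  shiftedVersion : ∀ s E → Symmetric E → Irreflexive E → ShiftedVersion s E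
  shiftedVersion s E E-sym E-irr = iterate (suc (weight s E)) E E-sym E-irr ≤-refl
    where
    Violation : Graph → ℕ → ℕ → ℕ → Set
    Violation F i j x = i < j × x ≢ i × x ≢ j × F j x ≡ true × F i x ≡ false

    violation? : ∀ F → Dec (∃ λ i → i < s × ∃ λ j → j < s × ∃ λ x → x < s × Violation F i j x)
    violation? F = anyUpTo? (λ i → anyUpTo? (λ j → anyUpTo? (λ x →
      (i <? j) ×-dec ¬? (x ≟ i) ×-dec ¬? (x ≟ j) ×-dec (F j x ≟ᵇ true) ×-dec (F i x ≟ᵇ false)) s) s) s

    -- Each shift strictly lowers the weight, so weight + 1 shifts suffice.
    iterate : ∀ fuel F → Symmetric F → Irreflexive F → weight s F < fuel → ShiftedVersion s F
    iterate (suc fuel) F F-sym F-irr w<fuel with violation? F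
    ... | no none = record
      { graph = F ; symmetric = F-sym ; irreflexive = F-irr ; nonEdges-≡ = refl ; matching⇒ = λ M → M
      ; shifted = λ i j x i<j j<s x<s x≢i x≢j Fjx →
          ¬-not λ Fix≡false → none (i , <-trans i<j j<s , j , j<s , x , x<s , i<j , x≢i , x≢j , Fjx , Fix≡false) }
    ... | yes (i , i<s , j , j<s , x , x<s , i<j , x≢i , x≢j , Fjx , ¬Fix) = record
      { graph = graph ; symmetric = symmetric ; irreflexive = irreflexive ; shifted = shifted
      ; nonEdges-≡ = trans nonEdges-≡ (nonEdges-shift F i≢j i<s j<s)
      ; matching⇒ = λ M → unshift-matching F i≢j F-sym i<s j<s (matching⇒ M) }
      where
      i≢j : i ≢ j
      i≢j = <⇒≢ i<j
      open ShiftedVersion (iterate fuel (shift i j F) (shift-symmetric F i≢j F-sym) (shift-irreflexive F i≢j F-irr)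
        (<-≤-trans (weight-shift-< F i≢j i<j j<s x<s x≢i x≢j Fjx ¬Fix) (s≤s⁻¹ w<fuel)))

  module _ {s : ℕ} {E : Graph} (E-shifted : Shifted s E) (E-sym : Symmetric E) where

    private
      lower-end : ∀ {a i m} → a < s → m < s → i ≤ a → i < m → a ≢ m → E a m ≡ true → E i m ≡ true
      lower-end {a} {i} {m} a<s m<s i≤a i<m a≢m Eam with a ≟ i
      ... | yes refl = Eam
      ... | no a≢i = E-shifted i a m (≤∧≢⇒< i≤a (≢-sym a≢i)) a<s m<s (≢-sym (<⇒≢ i<m)) (≢-sym a≢m) Eam

      ordered : ∀ {a b i m} → a < b → b < s → E a b ≡ true → i ≤ a → m ≤ b → i < m → m < s → E i m ≡ true
      ordered {a} {b} {i} {m} a<b b<s Eab i≤a m≤b i<m m<s with b ≟ m | a ≟ m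
      ... | yes refl | _ = lower-end (<-trans a<b b<s) b<s i≤a i<m (<⇒≢ a<b) Eab
      ... | no _ | yes refl = E-shifted i b a (<-trans i<m a<b) b<s (<-trans a<b b<s) (≢-sym (<⇒≢ i<m)) (<⇒≢ a<b)
                                (trans (E-sym b a) Eab)
      ... | no b≢m | no a≢m = lower-end (<-trans a<b b<s) m<s i≤a i<m a≢m
        (trans (E-sym a m) (E-shifted m b a (≤∧≢⇒< m≤b (≢-sym b≢m)) b<s (<-trans a<b b<s) a≢m (<⇒≢ a<b)
                                        (trans (E-sym b a) Eab)))

    shifted-downward-closed : ∀ {a b i m} → a < s → b < s → a ≢ b → E a b ≡ true → i ≤ a → i ≤ b →
                              m ≤ a ⊎ m ≤ b → i < m → m < s → E i m ≡ true
    shifted-downward-closed {a} {b} a<s b<s a≢b Eab i≤a i≤b m≤a∨m≤b i<m m<s with <-cmp a b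
    ... | tri< a<b _ _ = ordered a<b b<s Eab i≤a ([ (λ m≤a → ≤-trans m≤a (<⇒≤ a<b)) , (λ m≤b → m≤b) ]′ m≤a∨m≤b) i<m m<s
    ... | tri≈ _ a≡b _ = ⊥-elim (a≢b a≡b)
    ... | tri> _ _ b<a = ordered b<a a<s (trans (E-sym b a) Eab) i≤b ([ (λ m≤a → m≤a) , (λ m≤b → ≤-trans m≤b (<⇒≤ b<a)) ]′ m≤a∨m≤b) i<m m<s

    shifted-nonEdges-≥ : ∀ {i m} → i < m → m < s → E i m ≡ false →
                         (s ∸ m) * (s ∸ i ∸ 1) + (m ∸ i) * (s ∸ m) ≤ nonEdges s E
    shifted-nonEdges-≥ {i} {m} i<m m<s ¬Eim = begin
      (s ∸ m) * K₁ + (m ∸ i) * K₂    ≡⟨ regions ⟨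
      ∑[ a < s ] rowBound a          ≤⟨ ∑-mono-≤ s rowBound≤ ⟩
      nonEdges s E                   ∎
      where
      open ≤-Reasoning
      K₁ : ℕ
      K₁ = s ∸ i ∸ 1
      K₂ : ℕ
      K₂ = s ∸ m
      -- a row a ≥ m misses every b ≥ i, and a row i ≤ a < m misses every b ≥ m
      rowBound : ℕ → ℕ
      rowBound a = 𝟙 (m ≤ᵇ a) * K₁ + 𝟙 ((i ≤ᵇ a) ∧ (a <ᵇ m)) * K₂

      regions : ∑[ a < s ] rowBound a ≡ (s ∸ m) * K₁ + (m ∸ i) * K₂
      regions = trans (∑-distrib-+ s _ _) (cong₂ _+_
        (trans (∑-𝟙-* s (m ≤ᵇ_) K₁) (cong (_* K₁) (count-≥ s m)))
        (trans (∑-𝟙-* s (λ a → (i ≤ᵇ a) ∧ (a <ᵇ m)) K₂) (cong (_* K₂) (count-interval s (<⇒≤ i<m) (<⇒≤ m<s)))))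

      no-edge : ∀ {a b} → a < s → b < s → a ≢ b → i ≤ a → i ≤ b → m ≤ a ⊎ m ≤ b → E a b ≡ false
      no-edge a<s b<s a≢b i≤a i≤b m≤a∨m≤b = ¬-not λ Eab → true≢false
        (trans (sym (shifted-downward-closed a<s b<s a≢b Eab i≤a i≤b m≤a∨m≤b i<m m<s)) ¬Eim)

      rowBound≤ : ∀ a → a < s → rowBound a ≤ nonNeighbours s E a
      rowBound≤ a a<s with m ≤? a
      ... | yes m≤a rewrite ≤ᵇ-true⁺ m≤a | <ᵇ-false⁺ (≤⇒≯ m≤a) | ∧-zeroʳ (i ≤ᵇ a) | *-identityˡ K₁ | +-identityʳ K₁ =
        subst (_≤ nonNeighbours s E a) (count-≥-except s i≤a a<s) (count-mono s missed)
        where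
        i≤a : i ≤ a
        i≤a = ≤-trans (<⇒≤ i<m) m≤a
        missed : ∀ b → b < s → (i ≤ᵇ b) ∧ not (b ≡ᵇ a) ≡ true → not (a ≡ᵇ b) ∧ not (E a b) ≡ true
        missed b b<s h = let (i≤ᵇb , b≢ᵇa) = ∧-true⁻ h ; a≢b = ≢-sym (≡ᵇ-false⁻ (not-true⁻ b≢ᵇa)) in
          ∧-true⁺ (not-true⁺ (≡ᵇ-false⁺ a≢b)) (not-true⁺ (no-edge a<s b<s a≢b i≤a (≤ᵇ-true⁻ i≤ᵇb) (inj₁ m≤a)))
      ... | no m≰a rewrite ≤ᵇ-false⁺ m≰a | <ᵇ-true⁺ (≰⇒> m≰a) with i ≤? a
      ...   | no i≰a rewrite ≤ᵇ-false⁺ i≰a = z≤n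
      ...   | yes i≤a rewrite ≤ᵇ-true⁺ i≤a | *-identityˡ K₂ =
        subst (_≤ nonNeighbours s E a) (count-≥ s m) (count-mono s missed)
        where
        missed : ∀ b → b < s → (m ≤ᵇ b) ≡ true → not (a ≡ᵇ b) ∧ not (E a b) ≡ true
        missed b b<s m≤ᵇb = let m≤b = ≤ᵇ-true⁻ m≤ᵇb ; a≢b = <⇒≢ (<-≤-trans (≰⇒> m≰a) m≤b) in
          ∧-true⁺ (not-true⁺ (≡ᵇ-false⁺ a≢b)) (not-true⁺ (no-edge a<s b<s a≢b i≤a (≤-trans (<⇒≤ i<m) m≤b) (inj₂ m≤b)))

  egBound : ℕ → ℕ → ℕ
  egBound t j = (t ∸ j) * (t + 3 * j + 1)

  private
    regions≡egBound : ∀ {s k i j} → suc i + j ≡ k → k + j ≤ s →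
                      (s ∸ (k + j)) * (s ∸ i ∸ 1) + (k + j ∸ i) * (s ∸ (k + j)) ≡ egBound (s ∸ k) j
    regions≡egBound {s} {_} {i} {j} refl m≤s = subst
      (λ s′ → (s′ ∸ m) * (s′ ∸ i ∸ 1) + (m ∸ i) * (s′ ∸ m) ≡ egBound (s′ ∸ k) j)
      (m+[n∸m]≡n m≤s) (closed-form (s ∸ m))
      where
      k : ℕ
      k = suc i + j
      m : ℕ
      m = k + j
      closed-form : ∀ w → ((m + w) ∸ m) * ((m + w) ∸ i ∸ 1) + (m ∸ i) * ((m + w) ∸ m) ≡ egBound ((m + w) ∸ k) j
      closed-form w = begin
        (m + w ∸ m) * (m + w ∸ i ∸ 1) + (m ∸ i) * (m + w ∸ m) ≡⟨ cong (λ x → x * (m + w ∸ i ∸ 1) + (m ∸ i) * x) (m+n∸m≡n m w) ⟩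
        w * (m + w ∸ i ∸ 1) + (m ∸ i) * w                     ≡⟨ cong₂ (λ a b → w * a + b * w) s-i-1≡ m-i≡ ⟩
        w * (j + j + w) + suc (j + j) * w                     ≡⟨ regions j w ⟩
        w * (j + w + 3 * j + 1)                               ≡⟨ cong₂ (λ a b → a * (b + 3 * j + 1)) s-k-j≡ s-k≡ ⟨
        egBound (m + w ∸ k) j                                 ∎
        where
        open ≡-Reasoning
        s-i-1≡ : m + w ∸ i ∸ 1 ≡ j + j + w
        s-i-1≡ = trans (∸-+-assoc (m + w) i 1) (trans (cong (_∸ (i + 1)) (shape₁ i j w)) (m+n∸m≡n (i + 1) (j + j + w)))
          where
          shape₁ : ∀ i j w → suc i + j + j + w ≡ i + 1 + (j + j + w)
          shape₁ = solve-∀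
        m-i≡ : m ∸ i ≡ suc (j + j)
        m-i≡ = trans (cong (_∸ i) (shape₂ i j)) (m+n∸m≡n i (suc (j + j)))
          where
          shape₂ : ∀ i j → suc i + j + j ≡ i + suc (j + j)
          shape₂ = solve-∀
        s-k≡ : m + w ∸ k ≡ j + w
        s-k≡ = trans (cong (_∸ k) (+-assoc k j w)) (m+n∸m≡n k (j + w))
        s-k-j≡ : m + w ∸ k ∸ j ≡ w
        s-k-j≡ = trans (cong (_∸ j) s-k≡) (m+n∸m≡n j w)
        regions : ∀ j w → w * (j + j + w) + suc (j + j) * w ≡ w * (j + w + 3 * j + 1)
        regions = solve-∀

  -- In the shifted version, some antipodal pair (i, 2k-1-i) is a non-edge, else it would be a k-matching;
  -- by downward closure that non-edge forces the two regions of non-edges counted in shifted-nonEdges-≥.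
  ¬matching⇒egBound≤nonEdges : ∀ s k (E : Graph) → Symmetric E → Irreflexive E → k + k ≤ s → ¬ Matching s k E →
                               ∃ λ j → j < k × egBound (s ∸ k) j ≤ nonEdges s E
  ¬matching⇒egBound≤nonEdges s k E E-sym E-irr 2k≤s ¬M = by-cases (anyUpTo? (λ l → E′ l (partner l) ≟ᵇ false) k)
    where
    open ShiftedVersion (shiftedVersion s E E-sym E-irr) renaming (graph to E′)

    partner : ℕ → ℕ
    partner l = k + (k ∸ suc l)

    antipodal : (∀ l → l < k → E′ l (partner l) ≡ true) → Matching s k E′
    antipodal edges = record
      { left = λ l → l ; right = partner
      ; left-< = λ l l<k → <-≤-trans l<k (≤-trans (m≤m+n k k) 2k≤s)
      ; right-< = λ l l<k → <-≤-trans (+-monoʳ-< k (∸-monoʳ-< {k} {suc l} {0} (s≤s z≤n) l<k)) 2k≤s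
      ; edge = edges
      ; left-injective = λ _ _ _ _ eq → eq
      ; right-injective = λ l l′ l<k l′<k eq → suc-injective (∸-cancelˡ-≡ l<k l′<k (+-cancelˡ-≡ k _ _ eq))
      ; left≢right = λ l l′ l<k l′<k → <⇒≢ (<-≤-trans l<k (m≤m+n k _)) }

    by-cases : Dec (∃ λ l → l < k × E′ l (partner l) ≡ false) → ∃ λ j → j < k × egBound (s ∸ k) j ≤ nonEdges s E
    by-cases (no none) = ⊥-elim (¬M (matching⇒ (antipodal λ l l<k → ¬-not λ ¬E′ → none (l , l<k , ¬E′))))
    by-cases (yes (i , i<k , ¬E′)) = j , j<k , subst₂ _≤_ regions≡ nonEdges-≡
      (shifted-nonEdges-≥ shifted symmetric i<m m<s ¬E′)
      where
      j : ℕ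
      j = k ∸ suc i
      m : ℕ
      m = k + j
      i+1+j≡k : suc i + j ≡ k
      i+1+j≡k = m+[n∸m]≡n i<k
      j<k : j < k
      j<k = subst (j <_) i+1+j≡k (s≤s (m≤n+m j i))
      i<m : i < m
      i<m = <-≤-trans i<k (m≤m+n k j)
      m<s : m < s
      m<s = <-≤-trans (+-monoʳ-< k j<k) 2k≤s
      regions≡ : (s ∸ m) * (s ∸ i ∸ 1) + (m ∸ i) * (s ∸ m) ≡ egBound (s ∸ k) j
      regions≡ = regions≡egBound i+1+j≡k (<⇒≤ m<s)

module Threshold where

  open import Data.Nat
  open import Data.Nat.Properties
  open import Data.Nat.Tactic.RingSolver using (solve-∀)
  open import Data.Product using (_,_)
  open import Data.Sum using (inj₁; inj₂)
  open import Relation.Nullary using (¬_; Dec)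
  open import Relation.Nullary.Decidable using (_×-dec_; map′)
  open import Relation.Binary.PropositionalEquality
  open import Defs using (BelowBound)
  open ErdosGallai using (egBound)

  sq : ℕ → ℕ
  sq n = n * n

  sq-mono-≤ : ∀ {m n} → m ≤ n → sq m ≤ sq n
  sq-mono-≤ m≤n = *-mono-≤ m≤n m≤n

  sq-cancel-≤ : ∀ {m n} → sq m ≤ sq n → m ≤ n
  sq-cancel-≤ m²≤n² = ≮⇒≥ λ n<m → <⇒≱ (*-mono-< n<m n<m) m²≤n²

  infix 4 θ⋅_≤_

  -- θ ⋅ n ≤ X for θ = (15 + √33)/24, that is 24 X - 15 n ≥ √33 n, with the square root squared away.
  record θ⋅_≤_ (n X : ℕ) : Set where
    constructor θ-bound
    field
      linear : 15 * n < 24 * X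
      square : 33 * sq n ≤ sq (24 * X ∸ 15 * n)

  θ⋅?≤? : ∀ n X → Dec (θ⋅ n ≤ X)
  θ⋅?≤? n X = map′ (λ (l , s) → θ-bound l s) (λ (θ-bound l s) → l , s)
    ((15 * n <? 24 * X) ×-dec (33 * sq n ≤? sq (24 * X ∸ 15 * n)))

  θ⋅≤-mono : ∀ {n X Y} → X ≤ Y → θ⋅ n ≤ X → θ⋅ n ≤ Y
  θ⋅≤-mono {n} X≤Y (θ-bound 15n<24X 33n²≤d²) = θ-bound
    (<-≤-trans 15n<24X (*-monoʳ-≤ 24 X≤Y))
    (≤-trans 33n²≤d² (sq-mono-≤ (∸-monoˡ-≤ (15 * n) (*-monoʳ-≤ 24 X≤Y))))

  -- θ < 21/24, as √33 < 6.
  θ⋅≤-of-21 : ∀ {n X} → 0 < n → 21 * n ≤ 24 * X → θ⋅ n ≤ X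
  θ⋅≤-of-21 {n} {X} 0<n 21n≤24X = θ-bound (<-≤-trans (*-monoˡ-< n ⦃ >-nonZero 0<n ⦄ (s≤s (m≤m+n 15 5))) 21n≤24X) 33n²≤d²
    where
    6n≤d : 6 * n ≤ 24 * X ∸ 15 * n
    6n≤d = subst (_≤ 24 * X ∸ 15 * n) (m+n∸m≡n (15 * n) (6 * n))
      (∸-monoˡ-≤ (15 * n) (subst (_≤ 24 * X) (21n≡15n+6n n) 21n≤24X))
      where
      21n≡15n+6n : ∀ n → 21 * n ≡ 15 * n + 6 * n
      21n≡15n+6n = solve-∀
    33n²≤d² : 33 * sq n ≤ sq (24 * X ∸ 15 * n)
    33n²≤d² = ≤-trans (*-monoˡ-≤ (sq n) (m≤m+n 33 3)) (subst (_≤ sq (24 * X ∸ 15 * n)) (36n²≡[6n]² n) (sq-mono-≤ 6n≤d))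
      where
      36n²≡[6n]² : ∀ n → (6 * n) * (6 * n) ≡ 36 * (n * n)
      36n²≡[6n]² = solve-∀

  θ⋅≤-of-≤ : ∀ {n X} → 0 < n → n ≤ X → θ⋅ n ≤ X
  θ⋅≤-of-≤ {n} {X} 0<n n≤X = θ⋅≤-of-21 {n} {X} 0<n (≤-trans (*-monoˡ-≤ n (m≤m+n 21 3)) (*-monoʳ-≤ 24 n≤X))

  -- If d ≥ √33 m and e ≥ √33 n, then d e ≥ 33 m n, hence (d + e)² ≥ 33 (m + n)².
  θ⋅≤-superadditive : ∀ {m n X Y} → θ⋅ m ≤ X → θ⋅ n ≤ Y → θ⋅ (m + n) ≤ X + Y
  θ⋅≤-superadditive {m} {n} {X} {Y} (θ-bound 15m<24X 33m²≤d²) (θ-bound 15n<24Y 33n²≤e²) = θ-bound 15[m+n]<24[X+Y] 33[m+n]²≤[d+e]²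
    where
    d : ℕ
    d = 24 * X ∸ 15 * m
    e : ℕ
    e = 24 * Y ∸ 15 * n

    15[m+n]<24[X+Y] : 15 * (m + n) < 24 * (X + Y)
    15[m+n]<24[X+Y] = subst₂ _<_ (sym (*-distribˡ-+ 15 m n)) (sym (*-distribˡ-+ 24 X Y)) (+-mono-< 15m<24X 15n<24Y)

    difference≡d+e : 24 * (X + Y) ∸ 15 * (m + n) ≡ d + e
    difference≡d+e = begin
      24 * (X + Y) ∸ 15 * (m + n)                  ≡⟨ cong₂ _∸_ (*-distribˡ-+ 24 X Y) (*-distribˡ-+ 15 m n) ⟩
      (24 * X + 24 * Y) ∸ (15 * m + 15 * n)        ≡⟨ cong₂ (λ a b → a + b ∸ (15 * m + 15 * n))
                                                        (m+[n∸m]≡n (<⇒≤ 15m<24X)) (m+[n∸m]≡n (<⇒≤ 15n<24Y)) ⟨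
      (15 * m + d) + (15 * n + e) ∸ (15 * m + 15 * n) ≡⟨ cong (_∸ (15 * m + 15 * n)) (+-comm-middle (15 * m) d (15 * n) e) ⟩
      (15 * m + 15 * n) + (d + e) ∸ (15 * m + 15 * n) ≡⟨ m+n∸m≡n (15 * m + 15 * n) (d + e) ⟩
      d + e                                        ∎
      where
      open ≡-Reasoning
      +-comm-middle : ∀ a b c d → (a + b) + (c + d) ≡ (a + c) + (b + d)
      +-comm-middle = solve-∀

    33mn≤de : 33 * m * n ≤ d * e
    33mn≤de = sq-cancel-≤ (subst₂ _≤_ (sym (sq-product m n)) (sym (sq-product-comm d e)) (*-mono-≤ 33m²≤d² 33n²≤e²))
      where
      sq-product : ∀ m n → (33 * m * n) * (33 * m * n) ≡ (33 * (m * m)) * (33 * (n * n))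
      sq-product = solve-∀
      sq-product-comm : ∀ d e → (d * e) * (d * e) ≡ (d * d) * (e * e)
      sq-product-comm = solve-∀

    33[m+n]²≤[d+e]² : 33 * sq (m + n) ≤ sq (24 * (X + Y) ∸ 15 * (m + n))
    33[m+n]²≤[d+e]² = subst₂ _≤_ (sym (expand-33 m n)) (sym (trans (cong sq difference≡d+e) (expand d e)))
      (+-mono-≤ (+-mono-≤ 33m²≤d² (*-monoʳ-≤ 2 33mn≤de)) 33n²≤e²)
      where
      expand-33 : ∀ m n → 33 * ((m + n) * (m + n)) ≡ 33 * (m * m) + 2 * (33 * m * n) + 33 * (n * n)
      expand-33 = solve-∀
      expand : ∀ d e → (d + e) * (d + e) ≡ d * d + 2 * (d * e) + e * e
      expand = solve-∀

  private
    ^2≡sq : ∀ n → n ^ 2 ≡ sq n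
    ^2≡sq n = cong (n *_) (*-identityʳ n)

    ^4≡sq∘sq : ∀ n → n ^ 4 ≡ sq (sq n)
    ^4≡sq∘sq = unfolded
      where
      unfolded : ∀ n → n * (n * (n * (n * 1))) ≡ (n * n) * (n * n)
      unfolded = solve-∀

  θ⋅sq≤⇒¬BelowBound : ∀ {t X} → θ⋅ sq t ≤ X → ¬ BelowBound t X
  θ⋅sq≤⇒¬BelowBound {t} {X} (θ-bound 15t²<24X _) (inj₁ 24X≤15t²) =
    <⇒≱ 15t²<24X (subst (λ z → 24 * X ≤ 15 * z) (^2≡sq t) 24X≤15t²)
  θ⋅sq≤⇒¬BelowBound {t} {X} (θ-bound _ 33t⁴≤d²) (inj₂ (d , 24X≡15t²+d , d²<33t⁴)) =
    <⇒≱ (subst₂ _<_ (trans (^2≡sq d) (cong sq d≡)) (cong (33 *_) (^4≡sq∘sq t)) d²<33t⁴) 33t⁴≤d²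
    where
    d≡ : d ≡ 24 * X ∸ 15 * sq t
    d≡ = sym (trans (cong (_∸ 15 * sq t) (trans 24X≡15t²+d (cong (λ z → 15 * z + d) (^2≡sq t))))
                    (m+n∸m≡n (15 * sq t) d))

  odd : ℕ → ℕ
  odd p = suc (p + p)

  θ⋅sq-suc≤ : ∀ {p X Y} → θ⋅ sq p ≤ X → θ⋅ odd p ≤ Y → θ⋅ sq (suc p) ≤ X + Y
  θ⋅sq-suc≤ {p} {X} {Y} θp²≤X θ[2p+1]≤Y =
    subst (θ⋅_≤ X + Y) (sym (sq-suc p)) (θ⋅≤-superadditive θp²≤X θ[2p+1]≤Y)
    where
    sq-suc : ∀ p → (suc p) * (suc p) ≡ p * p + suc (p + p)
    sq-suc = solve-∀

  ≤2p-of-¬θ⋅odd≤ : ∀ p {s} → ¬ (θ⋅ odd p ≤ s) → s ≤ p + p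
  ≤2p-of-¬θ⋅odd≤ p ¬θ[2p+1]≤s = ≮⇒≥ λ 2p<s → ¬θ[2p+1]≤s (θ⋅≤-of-≤ (s≤s z≤n) 2p<s)

  sq≤egBound : ∀ j u → j ≤ 2 * u → sq (j + u) ≤ egBound (j + u) j
  sq≤egBound j u j≤2u = subst (λ v → sq (j + u) ≤ v * (j + u + 3 * j + 1)) (sym (m+n∸m≡n j u))
    (+-cancelʳ-≤ (2 * u * j) _ _ (begin
      sq (j + u) + 2 * u * j                  ≤⟨ m≤m+n _ u ⟩
      sq (j + u) + 2 * u * j + u              ≡⟨ expand j u ⟩
      u * (j + u + 3 * j + 1) + j * j         ≤⟨ +-monoʳ-≤ _ (*-monoˡ-≤ j j≤2u) ⟩
      u * (j + u + 3 * j + 1) + 2 * u * j     ∎))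
    where
    open ≤-Reasoning
    expand : ∀ j u → (j + u) * (j + u) + 2 * u * j + u ≡ u * (j + u + 3 * j + 1) + j * j
    expand = solve-∀

  θ⋅sq≤egBound-small-j : ∀ p j → j ≤ p → 24 * (suc p + suc j) ≤ 20 * odd p → θ⋅ sq (suc p) ≤ egBound (suc p) j + 1
  θ⋅sq≤egBound-small-j p j j≤p small = θ⋅≤-of-≤ (s≤s z≤n) (≤-trans t²≤egBound (m≤m+n _ 1))
    where
    u : ℕ
    u = suc p ∸ j
    j+u≡t : j + u ≡ suc p
    j+u≡t = m+[n∸m]≡n (m≤n⇒m≤1+n j≤p)
    j≤2u : j ≤ 2 * u
    j≤2u = *-cancelˡ-≤ 8 (≤-trans (m≤m+n (8 * j) 44) (+-cancelʳ-≤ (40 * j + 24 * u) _ _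
      (subst₂ _≤_ (lhs j u) (rhs j u) (subst (λ t → 24 * (t + suc j) + 20 ≤ 40 * t) (sym j+u≡t)
        (subst (24 * (suc p + suc j) + 20 ≤_) (20[2p+1]+20≡40t p) (+-monoˡ-≤ 20 small))))))
      where
      20[2p+1]+20≡40t : ∀ p → 20 * suc (p + p) + 20 ≡ 40 * suc p
      20[2p+1]+20≡40t = solve-∀
      lhs : ∀ j u → 24 * ((j + u) + suc j) + 20 ≡ 8 * j + 44 + (40 * j + 24 * u)
      lhs = solve-∀
      rhs : ∀ j u → 40 * (j + u) ≡ 8 * (2 * u) + (40 * j + 24 * u)
      rhs = solve-∀
    t²≤egBound : sq (suc p) ≤ egBound (suc p) j
    t²≤egBound = subst (λ t → sq t ≤ egBound t j) j+u≡t (sq≤egBound j u j≤2u)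

module ThresholdCertificate where

  open import Data.Nat as ℕ using (z≤n; s≤s)
  import Data.Nat.Properties as ℕ
  open ErdosGallai using (egBound)
  open Threshold using (sq; odd; θ⋅_≤_; θ-bound; ≤2p-of-¬θ⋅odd≤; θ⋅sq≤egBound-small-j)
  open import Relation.Nullary using (¬_; Dec; yes; no)
  open import Data.Integer
  open import Data.Integer.Properties
  open import Data.Integer.Tactic.RingSolver using (solve-∀)
  open import Data.Product using (_×_; _,_; proj₁; proj₂)
  import Data.Nat.Tactic.RingSolver as ℕ-Solver
  open import Relation.Binary.PropositionalEquality using (_≡_; sym; trans; cong; cong₂; subst; subst₂; module ≡-Reasoning)

  0≤+ : ∀ n → 0ℤ ≤ + n
  0≤+ n = +≤+ z≤n

  0≤-* : ∀ {a b} → 0ℤ ≤ a → 0ℤ ≤ b → 0ℤ ≤ a * b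
  0≤-* {+ m} {+ n} _ _ = subst (0ℤ ≤_) (pos-* m n) (0≤+ _)

  ≤-by-difference : ∀ {a b} e → b - a ≡ e → 0ℤ ≤ e → a ≤ b
  ≤-by-difference e b-a≡e 0≤e = 0≤i-j⇒j≤i (subst (0ℤ ≤_) (sym b-a≡e) 0≤e)

  sq-mono-≤ : ∀ {a b} → 0ℤ ≤ a → a ≤ b → a * a ≤ b * b
  sq-mono-≤ {a} {b} 0≤a a≤b = ≤-by-difference ((b - a) * (b + a)) (difference-of-squares a b)
    (0≤-* (i≤j⇒0≤j-i a≤b) (+-mono-≤ (≤-trans 0≤a a≤b) 0≤a))
    where
    difference-of-squares : ∀ a b → b * b - a * a ≡ (b - a) * (b + a)
    difference-of-squares = solve-∀

  sq-cancel-≤ : ∀ {a b} → 0ℤ ≤ b → a * a ≤ b * b → a ≤ b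
  sq-cancel-≤ { -[1+ _ ]} {+ _} _ _ = -≤+
  sq-cancel-≤ {+ m} {+ n} _ m²≤n² = +≤+ (Data.Nat.Properties.≮⇒≥ λ n<m →
    Data.Nat.Properties.<⇒≱ (Data.Nat.Properties.*-mono-< n<m n<m)
      (drop‿+≤+ (subst₂ _≤_ (sym (pos-* m m)) (sym (pos-* n n)) m²≤n²)))
    where import Data.Nat.Properties

  private
    y-2t≡ : ∀ t y → let q = + 2 * t - + 1 in
      y - + 2 * t ≡ (y - (+ 5 * q + + 1)) + + 8 * (t - + 2) + + 12
    y-2t≡ = solve-∀

    a²-r²≡ : ∀ t y →
      let q = + 2 * t - + 1 ; g = + 33 * (q * q) - y * y
          a = g + + 4 * t * y ; b = g + + 8 * t * (y - + 2 * t) ; r = + 44 * (t * t) - + 23 * t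
      in a * a - r * r ≡ t * t * (+ 176 * ((t - + 2) * (t - + 2)) + + 616 * (t - + 2) + + 527) + g * b
    a²-r²≡ = solve-∀

    e-24t≡ : ∀ t y → let q = + 2 * t - + 1 ; e = + 120 * t + + 70 * y - + 1050 in
      e - + 24 * t ≡ + 70 * (y - (+ 5 * q + + 1)) + + 796 * (t - + 2) + + 262
    e-24t≡ = solve-∀

    8z≡a+e : ∀ t j →
      let q = + 2 * t - + 1 ; y = + 24 * (t + j + + 1) - + 15 * q
          z : ℤ
          z = + 24 * ((t - j) * (t + + 3 * j + + 1) + + 1) - + 15 * (t * t)
          g = + 33 * (q * q) - y * y ; a = g + + 4 * t * y ; e = + 120 * t + + 70 * y - + 1050
      in + 8 * z ≡ a + e
    8z≡a+e = solve-∀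

    [a+24t]²-2112t⁴≡ : ∀ t y →
      let q = + 2 * t - + 1 ; g = + 33 * (q * q) - y * y
          a = g + + 4 * t * y ; b = g + + 8 * t * (y - + 2 * t) ; r = + 44 * (t * t) - + 23 * t
      in (a + + 24 * t) * (a + + 24 * t) - + 2112 * ((t * t) * (t * t)) ≡ g * b + + 48 * t * (a - r)
    [a+24t]²-2112t⁴≡ = solve-∀

    64⋅33≡2112 : ∀ t → + 64 * (+ 33 * ((t * t) * (t * t))) ≡ + 2112 * ((t * t) * (t * t))
    64⋅33≡2112 = solve-∀

    [8z]²≡64z² : ∀ z → + 64 * (z * z) ≡ (+ 8 * z) * (+ 8 * z)
    [8z]²≡64z² = solve-∀

  -- With q = 2t - 1 and y = 24 (t + j + 1) - 15 q, the hypotheses say that 5q < y < √33 q.  The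
  -- certificate: 8 z = a + e with a = g + 4 t y, g = 33 q² - y², e = 120 t + 70 y - 1050, where
  -- e ≥ 24 t and a ≥ 44 t² - 23 t (compare squares), so that (8 z)² ≥ (a + 24 t)² ≥ 64 ⋅ 33 t⁴.
  egBound-certificate : ∀ t j →
    let q = + 2 * t - + 1
        y = + 24 * (t + j + + 1) - + 15 * q
        z = + 24 * ((t - j) * (t + + 3 * j + + 1) + + 1) - + 15 * (t * t)
    in + 2 ≤ t → + 5 * q < y → y * y < + 33 * (q * q) →
       0ℤ < z × + 33 * ((t * t) * (t * t)) ≤ z * z
  egBound-certificate t j 2≤t 5q<y y²<33q² = 0<z , 33t⁴≤z²
    where
    q : ℤ
    q = + 2 * t - + 1
    y : ℤ
    y = + 24 * (t + j + + 1) - + 15 * q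
    z : ℤ
    z = + 24 * ((t - j) * (t + + 3 * j + + 1) + + 1) - + 15 * (t * t)
    g : ℤ
    g = + 33 * (q * q) - y * y
    a : ℤ
    a = g + + 4 * t * y
    e : ℤ
    e = + 120 * t + + 70 * y - + 1050
    b : ℤ
    b = g + + 8 * t * (y - + 2 * t)
    r : ℤ
    r = + 44 * (t * t) - + 23 * t

    0≤t : 0ℤ ≤ t
    0≤t = ≤-trans (0≤+ 2) 2≤t
    0≤t-2 : 0ℤ ≤ t - + 2
    0≤t-2 = i≤j⇒0≤j-i 2≤t
    0≤g : 0ℤ ≤ g
    0≤g = i≤j⇒0≤j-i (<⇒≤ y²<33q²)
    0≤y-5q-1 : 0ℤ ≤ y - (+ 5 * q + + 1)
    0≤y-5q-1 = i≤j⇒0≤j-i (subst (_≤ y) (+-comm (+ 1) (+ 5 * q)) (i<j⇒suc[i]≤j 5q<y))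

    2t≤y : + 2 * t ≤ y
    2t≤y = ≤-by-difference (y - (+ 5 * q + + 1) + + 8 * (t - + 2) + + 12) (y-2t≡ t y)
      (+-mono-≤ (+-mono-≤ 0≤y-5q-1 (0≤-* (0≤+ 8) 0≤t-2)) (0≤+ 12))
    0≤a : 0ℤ ≤ a
    0≤a = +-mono-≤ 0≤g (0≤-* (0≤-* (0≤+ 4) 0≤t) (≤-trans (0≤-* (0≤+ 2) 0≤t) 2t≤y))
    0≤b : 0ℤ ≤ b
    0≤b = +-mono-≤ 0≤g (0≤-* (0≤-* (0≤+ 8) 0≤t) (i≤j⇒0≤j-i 2t≤y))

    r≤a : r ≤ a
    r≤a = sq-cancel-≤ 0≤a (≤-by-difference
      (t * t * (+ 176 * ((t - + 2) * (t - + 2)) + + 616 * (t - + 2) + + 527) + g * b) (a²-r²≡ t y)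
      (+-mono-≤ (0≤-* (0≤-* 0≤t 0≤t) (+-mono-≤ (+-mono-≤ (0≤-* (0≤+ 176) (0≤-* 0≤t-2 0≤t-2))
                                                         (0≤-* (0≤+ 616) 0≤t-2)) (0≤+ 527)))
                (0≤-* 0≤g 0≤b)))
    24t≤e : + 24 * t ≤ e
    24t≤e = ≤-by-difference (+ 70 * (y - (+ 5 * q + + 1)) + + 796 * (t - + 2) + + 262) (e-24t≡ t y)
      (+-mono-≤ (+-mono-≤ (0≤-* (0≤+ 70) 0≤y-5q-1) (0≤-* (0≤+ 796) 0≤t-2)) (0≤+ 262))
    a+24t≤8z : a + + 24 * t ≤ + 8 * z
    a+24t≤8z = subst (a + + 24 * t ≤_) (sym (8z≡a+e t j)) (+-monoʳ-≤ a 24t≤e)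

    0<z : 0ℤ < z
    0<z = positive-of-8 (<-≤-trans 0<a+24t a+24t≤8z)
      where
      0<a+24t : 0ℤ < a + + 24 * t
      0<a+24t = +-mono-≤-< 0≤a (<-≤-trans (+<+ (s≤s z≤n)) (*-monoˡ-≤-nonNeg (+ 24) 2≤t))
      positive-of-8 : ∀ {x} → 0ℤ < + 8 * x → 0ℤ < x
      positive-of-8 {+[1+ _ ]} _ = +<+ (s≤s z≤n)
      positive-of-8 {+0} (+<+ ())
      positive-of-8 { -[1+ _ ]} ()

    33t⁴≤z² : + 33 * ((t * t) * (t * t)) ≤ z * z
    33t⁴≤z² = *-cancelˡ-≤-pos _ _ (+ 64) (subst₂ _≤_ (sym (64⋅33≡2112 t)) (sym ([8z]²≡64z² z)) (begin
      + 2112 * ((t * t) * (t * t))   ≤⟨ ≤-by-difference (g * b + + 48 * t * (a - r)) ([a+24t]²-2112t⁴≡ t y)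
                                          (+-mono-≤ (0≤-* 0≤g 0≤b) (0≤-* (0≤-* (0≤+ 48) 0≤t) (i≤j⇒0≤j-i r≤a))) ⟩
      (a + + 24 * t) * (a + + 24 * t) ≤⟨ sq-mono-≤ (+-mono-≤ 0≤a (0≤-* (0≤+ 24) 0≤t)) a+24t≤8z ⟩
      (+ 8 * z) * (+ 8 * z)          ∎))
      where open ≤-Reasoning

  +-∸ : ∀ {m n} → n ℕ.≤ m → + (m ℕ.∸ n) ≡ + m - + n
  +-∸ {m} {n} n≤m = sym (trans (m-n≡m⊖n m n) (⊖-≥ n≤m))

  private
    module Casts (p j : ℕ.ℕ) where
      t : ℕ.ℕ
      t = ℕ.suc p
      s : ℕ.ℕ
      s = t ℕ.+ ℕ.suc j
      y : ℕ.ℕ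
      y = 24 ℕ.* s ℕ.∸ 15 ℕ.* odd p
      X : ℕ.ℕ
      X = egBound t j ℕ.+ 1
      T : ℤ
      T = + t
      J : ℤ
      J = + j
      qℤ : ℤ
      qℤ = + 2 * T - + 1
      yℤ : ℤ
      yℤ = + 24 * (T + J + + 1) - + 15 * qℤ
      zℤ : ℤ
      zℤ = + 24 * ((T - J) * (T + + 3 * J + + 1) + + 1) - + 15 * (T * T)

      cast-q : + odd p ≡ qℤ
      cast-q = odd-as-2t-1 (+ p)
        where
        odd-as-2t-1 : ∀ P → + 1 + (P + P) ≡ + 2 * (+ 1 + P) - + 1
        odd-as-2t-1 = solve-∀

      cast-y : 15 ℕ.* odd p ℕ.≤ 24 ℕ.* s → + y ≡ yℤ
      cast-y 15q≤24s = begin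
        + y                                ≡⟨ +-∸ 15q≤24s ⟩
        + (24 ℕ.* s) - + (15 ℕ.* odd p)    ≡⟨ cong₂ _-_ (pos-* 24 s) (trans (pos-* 15 (odd p)) (cong (+ 15 *_) cast-q)) ⟩
        + 24 * (T + (+ 1 + J)) - + 15 * qℤ ≡⟨ cong (λ x → + 24 * x - + 15 * qℤ) (+-rearrange T J) ⟩
        yℤ                                 ∎
        where
        open ≡-Reasoning
        +-rearrange : ∀ T J → T + (+ 1 + J) ≡ T + J + + 1
        +-rearrange = solve-∀

      cast-X : j ℕ.≤ p → + X ≡ (T - J) * (T + + 3 * J + + 1) + + 1
      cast-X j≤p = cong (_+ + 1) (trans (pos-* (t ℕ.∸ j) (t ℕ.+ 3 ℕ.* j ℕ.+ 1))
        (cong₂ _*_ (+-∸ (ℕ.m≤n⇒m≤1+n j≤p)) (cong (λ x → T + x + + 1) (pos-* 3 j))))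

      cast-z : j ℕ.≤ p → + (24 ℕ.* X) - + (15 ℕ.* sq t) ≡ zℤ
      cast-z j≤p = cong₂ _-_ (trans (pos-* 24 X) (cong (+ 24 *_) (cast-X j≤p)))
                             (trans (pos-* 15 (sq t)) (cong (+ 15 *_) (pos-* t t)))

  θ⋅sq≤egBound-large-j : ∀ p j → 1 ℕ.≤ p → j ℕ.≤ p →
    let t = ℕ.suc p ; s = t ℕ.+ ℕ.suc j ; y = 24 ℕ.* s ℕ.∸ 15 ℕ.* odd p in
    20 ℕ.* odd p ℕ.< 24 ℕ.* s → sq y ℕ.< 33 ℕ.* sq (odd p) → θ⋅ sq t ≤ egBound t j ℕ.+ 1
  θ⋅sq≤egBound-large-j p j 1≤p j≤p 20q<24s y²<33q²ℕ = θ-bound 15t²<24X 33t⁴≤z²ℕ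
    where
    open Casts p j
    15q≤24s : 15 ℕ.* odd p ℕ.≤ 24 ℕ.* s
    15q≤24s = ℕ.<⇒≤ (ℕ.≤-<-trans (ℕ.*-monoˡ-≤ (odd p) (ℕ.m≤m+n 15 5)) 20q<24s)

    5q<y : + 5 * qℤ < yℤ
    5q<y = subst₂ _<_ (trans (pos-* 5 (odd p)) (cong (+ 5 *_) cast-q)) (cast-y 15q≤24s) (+<+ (ℕ.+-cancelˡ-< (15 ℕ.* odd p) _ _
      (subst₂ ℕ._<_ (20q≡15q+5q (odd p)) (sym (ℕ.m+[n∸m]≡n 15q≤24s)) 20q<24s)))
      where
      20q≡15q+5q : ∀ q → 20 ℕ.* q ≡ 15 ℕ.* q ℕ.+ 5 ℕ.* q
      20q≡15q+5q = ℕ-Solver.solve-∀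
    y²<33q² : yℤ * yℤ < + 33 * (qℤ * qℤ)
    y²<33q² = subst₂ _<_ (trans (pos-* y y) (cong₂ _*_ (cast-y 15q≤24s) (cast-y 15q≤24s)))
      (trans (pos-* 33 (sq (odd p))) (cong (+ 33 *_) (trans (pos-* (odd p) (odd p)) (cong₂ _*_ cast-q cast-q))))
      (+<+ y²<33q²ℕ)

    certificate : 0ℤ < zℤ × + 33 * ((T * T) * (T * T)) ≤ zℤ * zℤ
    certificate = egBound-certificate T J (+≤+ (s≤s 1≤p)) 5q<y y²<33q²

    15t²<24X : 15 ℕ.* sq t ℕ.< 24 ℕ.* X
    15t²<24X = ℕ.≰⇒> λ 24X≤15t² → <⇒≱ (proj₁ certificate) (subst (_≤ 0ℤ) (cast-z j≤p) (i≤j⇒i-j≤0 (+≤+ 24X≤15t²)))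

    zℕ : ℕ.ℕ
    zℕ = 24 ℕ.* X ℕ.∸ 15 ℕ.* sq t
    cast-zℕ : + zℕ ≡ zℤ
    cast-zℕ = trans (+-∸ (ℕ.<⇒≤ 15t²<24X)) (cast-z j≤p)

    33t⁴≤z²ℕ : 33 ℕ.* sq (sq t) ℕ.≤ sq zℕ
    33t⁴≤z²ℕ = drop‿+≤+ (subst₂ _≤_
      (sym (trans (pos-* 33 (sq (sq t))) (cong (+ 33 *_) (trans (pos-* (sq t) (sq t)) (cong₂ _*_ (pos-* t t) (pos-* t t))))))
      (sym (trans (pos-* zℕ zℕ) (cong₂ _*_ cast-zℕ cast-zℕ)))
      (proj₂ certificate))

  egBound-clears-threshold : ∀ p j → 1 ℕ.≤ p → ¬ (θ⋅ odd p ≤ ℕ.suc p ℕ.+ ℕ.suc j) →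
                             θ⋅ sq (ℕ.suc p) ≤ egBound (ℕ.suc p) j ℕ.+ 1
  egBound-clears-threshold p j 1≤p ¬θ⋅q≤s = by-cases (24 ℕ.* s ℕ.≤? 20 ℕ.* odd p)
    where
    s : ℕ.ℕ
    s = ℕ.suc p ℕ.+ ℕ.suc j
    j≤p : j ℕ.≤ p
    j≤p = ℕ.<⇒≤ (ℕ.+-cancelˡ-≤ (ℕ.suc p) (ℕ.suc j) p (ℕ.m≤n⇒m≤1+n (≤2p-of-¬θ⋅odd≤ p ¬θ⋅q≤s)))
    by-cases : Dec (24 ℕ.* s ℕ.≤ 20 ℕ.* odd p) → θ⋅ sq (ℕ.suc p) ≤ egBound (ℕ.suc p) j ℕ.+ 1
    by-cases (yes small) = θ⋅sq≤egBound-small-j p j j≤p small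
    by-cases (no ¬small) = θ⋅sq≤egBound-large-j p j 1≤p j≤p 20q<24s
      (ℕ.≰⇒> λ 33q²≤y² → ¬θ⋅q≤s (θ-bound (ℕ.≤-<-trans (ℕ.*-monoˡ-≤ (odd p) (ℕ.m≤m+n 15 5)) 20q<24s) 33q²≤y²))
      where
      20q<24s : 20 ℕ.* odd p ℕ.< 24 ℕ.* s
      20q<24s = ℕ.≰⇒> ¬small

module CoverFree (N W : ℕ) (M : ℕ → ℕ → Bool) where

  open import Data.Nat
  open import Data.Nat.Properties
  open import Data.Bool using (Bool; true; false; _∧_; _∨_; not; if_then_else_)
  open import Data.Bool.Properties using (∧-zeroʳ; ∧-identityʳ; ∨-identityʳ; ∧-comm; ¬-not) renaming (_≟_ to _≟ᵇ_)
  open import Data.Product using (∃; _×_; _,_; proj₁; proj₂)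
  open import Data.Sum using (inj₁; inj₂)
  open import Data.Empty using (⊥; ⊥-elim)
  open import Data.List using (List; []; _∷_; _++_; length)
  open import Data.List.Properties using (length-++)
  import Data.List.Relation.Unary.All.Properties as AllP
  open import Data.List.Relation.Unary.All as All using (All; []; _∷_)
  open import Relation.Nullary using (¬_; Dec; yes; no)
  open import Relation.Nullary.Decidable using (_×-dec_; ¬?)
  open import Relation.Binary.PropositionalEquality
  open Counting
  open Enumeration using (enumerate)
  open Threshold using (sq; odd; θ⋅_≤_; θ⋅?≤?; θ⋅≤-mono; θ⋅≤-of-≤; θ⋅sq-suc≤; ≤2p-of-¬θ⋅odd≤)
  open ThresholdCertificate using (egBound-clears-threshold)
  open ErdosGallai using (Graph; Symmetric; Irreflexive; Matching; nonEdges; egBound; ¬matching⇒egBound≤nonEdges)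

  OtherColumns : (ℕ → Bool) → ℕ → List ℕ → Set
  OtherColumns C i S = All (λ j → j < W × C j ≡ true × j ≢ i) S

  -- R and C select the rows and columns of the submatrix under consideration.
  CoverFree : ℕ → (ℕ → Bool) → (ℕ → Bool) → Set
  CoverFree t R C = ∀ i → i < W → C i ≡ true → ∀ S → OtherColumns C i S → length S ≤ t →
                    ∃ λ u → u < N × R u ≡ true × M u i ≡ true × All (λ j → M u j ≡ false) S

  HeavyColumn : (ℕ → Bool) → (ℕ → Bool) → Set
  HeavyColumn R C = ∃ λ i → i < W × C i ≡ true × ∃ λ u → u < N × ∃ λ v → v < N ×
                    u ≢ v × R u ≡ true × R v ≡ true × M u i ≡ true × M v i ≡ true

  heavy? : ∀ R C → Dec (HeavyColumn R C)
  heavy? R C = anyUpTo? (λ i → (C i ≟ᵇ true) ×-dec anyUpTo? (λ u → anyUpTo? (λ v →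
    ¬? (u ≟ v) ×-dec (R u ≟ᵇ true) ×-dec (R v ≟ᵇ true) ×-dec (M u i ≟ᵇ true) ×-dec (M v i ≟ᵇ true)) N) N) W

  column-nonempty : ∀ {t R C} → CoverFree t R C → ∀ i → i < W → C i ≡ true → ∃ λ u → u < N × R u ≡ true × M u i ≡ true
  column-nonempty cf i i<W Ci = let (u , u<N , Ru , Mui , _) = cf i i<W Ci [] [] z≤n in u , u<N , Ru , Mui

  columnWeight : (ℕ → Bool) → ℕ → ℕ
  columnWeight R i = count N (λ u → R u ∧ M u i)

  rowsOutside : (ℕ → Bool) → ℕ → ℕ → Bool
  rowsOutside R A u = R u ∧ not (M u A)

  columnsExcept : (ℕ → Bool) → ℕ → ℕ → Bool
  columnsExcept C A i = C i ∧ not (i ≡ᵇ A)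

  -- Add A to the cover: the free row it leaves avoids A, so it survives the deletion.
  CoverFree-delete : ∀ {t R C A} → CoverFree (suc t) R C → A < W → C A ≡ true →
                     CoverFree t (rowsOutside R A) (columnsExcept C A)
  CoverFree-delete {t} {R} {C} {A} cf A<W CA i i<W C′i S S-ok |S|≤t
    with cf i i<W Ci (A ∷ S) ((A<W , CA , A≢i) ∷ All.map widen S-ok) (s≤s |S|≤t)
    where
    Ci : C i ≡ true
    Ci = proj₁ (∧-true⁻ C′i)
    A≢i : A ≢ i
    A≢i = ≢-sym (≡ᵇ-false⁻ (not-true⁻ (proj₂ (∧-true⁻ C′i))))
    widen : ∀ {j} → j < W × columnsExcept C A j ≡ true × j ≢ i → j < W × C j ≡ true × j ≢ i
    widen (j<W , C′j , j≢i) = j<W , proj₁ (∧-true⁻ C′j) , j≢i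
  ... | u , u<N , Ru , Mui , MuA≡false ∷ MuS = u , u<N , ∧-true⁺ Ru (not-true⁺ MuA≡false) , Mui , MuS

  count-rowsOutside : ∀ R A → count N R ≡ count N (rowsOutside R A) + columnWeight R A
  count-rowsOutside R A = trans (count-split N R (λ u → M u A)) (+-comm (columnWeight R A) _)

  rowOf : (ℕ → Bool) → ℕ → ℕ
  rowOf R i = pick N (λ u → R u ∧ M u i)

  module _ {t R C} (cf : CoverFree t R C) where

    rowOf-spec : ∀ i → i < W → C i ≡ true → rowOf R i < N × R (rowOf R i) ≡ true × M (rowOf R i) i ≡ true
    rowOf-spec i i<W Ci =
      let (u , u<N , Ru , Mui) = column-nonempty cf i i<W Ci
          (ρ<N , picked) = pick-spec N u u<N (∧-true⁺ Ru Mui)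
      in ρ<N , ∧-true⁻ picked

    rowOf-unique : ¬ HeavyColumn R C → ∀ i → i < W → C i ≡ true → ∀ u → u < N → R u ≡ true → M u i ≡ true →
                    u ≡ rowOf R i
    rowOf-unique ¬heavy i i<W Ci u u<N Ru Mui with u ≟ rowOf R i
    ... | yes u≡ρ = u≡ρ
    ... | no u≢ρ = let (ρ<N , Rρ , Mρi) = rowOf-spec i i<W Ci in
      ⊥-elim (¬heavy (i , i<W , Ci , u , u<N , rowOf R i , ρ<N , u≢ρ , Ru , Rρ , Mui , Mρi))

  ¬heavy⇒columns≤rows : ∀ {t R C} → CoverFree (suc t) R C → ¬ HeavyColumn R C → count W C ≤ count N R
  ¬heavy⇒columns≤rows {R = R} {C} cf ¬heavy = count-injection W N (rowOf R)
    (λ i i<W Ci → let (ρ<N , Rρ , _) = rowOf-spec cf i i<W Ci in ρ<N , Rρ)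
    injective
    where
    -- Two columns with the same (only) row: the cover-free property for {i′} separates them.
    injective : ∀ i i′ → i < W → i′ < W → C i ≡ true → C i′ ≡ true → rowOf R i ≡ rowOf R i′ → i ≡ i′
    injective i i′ i<W i′<W Ci Ci′ same with i ≟ i′
    ... | yes i≡i′ = i≡i′
    ... | no i≢i′ with cf i i<W Ci (i′ ∷ []) ((i′<W , Ci′ , ≢-sym i≢i′) ∷ []) (s≤s z≤n)
    ...   | v , v<N , Rv , Mvi , Mvi′≡false ∷ [] = ⊥-elim (true≢false (trans (sym Mρi′) (trans (cong (λ z → M z i′) v≡ρ′) Mvi′≡false)))
      where
      Mρi′ : M (rowOf R i′) i′ ≡ true
      Mρi′ = proj₂ (proj₂ (rowOf-spec cf i′ i′<W Ci′))
      v≡ρ′ : rowOf R i′ ≡ v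
      v≡ρ′ = sym (trans (rowOf-unique cf ¬heavy i i<W Ci v v<N Rv Mvi) same)

  fewer-rows⇒heavy : ∀ {t R C} → CoverFree (suc t) R C → count N R < count W C → HeavyColumn R C
  fewer-rows⇒heavy {R = R} {C} cf rows<columns with heavy? R C
  ... | yes heavy = heavy
  ... | no ¬heavy = ⊥-elim (<⇒≱ rows<columns (¬heavy⇒columns≤rows cf ¬heavy))

  module Privacy (R C : ℕ → Bool) where

    privateTo : ℕ → ℕ → Bool
    privateTo u i = R u ∧ (C i ∧ (M u i ∧ all< W (λ j → (j ≡ᵇ i) ∨ not (C j ∧ M u j))))

    hasPrivate : ℕ → Bool
    hasPrivate i = any< N (λ u → privateTo u i)

    isPrivate : ℕ → Bool
    isPrivate u = any< W (λ i → privateTo u i)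

    lacksPrivate : ℕ → Bool
    lacksPrivate i = C i ∧ not (hasPrivate i)

    isShared : ℕ → Bool
    isShared u = R u ∧ not (isPrivate u)

    alsoIn : ℕ → ℕ → ℕ → Bool
    alsoIn i u v = any< W (λ j → not (j ≡ᵇ i) ∧ (C j ∧ (M u j ∧ M v j)))

    owns : ℕ → ℕ → ℕ → Bool
    owns i u v = not (u ≡ᵇ v) ∧ (R u ∧ (R v ∧ (M u i ∧ (M v i ∧ not (alsoIn i u v)))))

    ownedPairs : ℕ → ℕ
    ownedPairs i = ∑[ u < N ] count N (owns i u)

    privateTo⁻ : ∀ {u i} → privateTo u i ≡ true →
                 R u ≡ true × C i ≡ true × M u i ≡ true × all< W (λ j → (j ≡ᵇ i) ∨ not (C j ∧ M u j)) ≡ true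
    privateTo⁻ {u} {i} h =
      let (Ru , h₁) = ∧-true⁻ {R u} h ; (Ci , h₂) = ∧-true⁻ {C i} h₁ ; (Mui , only) = ∧-true⁻ {M u i} h₂
      in Ru , Ci , Mui , only

    privateTo-unique : ∀ {u i j} → privateTo u i ≡ true → j < W → C j ≡ true → M u j ≡ true → j ≡ i
    privateTo-unique {u} {i} {j} h j<W Cj Muj = ≡ᵇ-true⁻ (only-i (all<-true⁻ W (proj₂ (proj₂ (proj₂ (privateTo⁻ h)))) j j<W))
      where
      only-i : (j ≡ᵇ i) ∨ not (C j ∧ M u j) ≡ true → (j ≡ᵇ i) ≡ true
      only-i h rewrite Cj | Muj | ∨-identityʳ (j ≡ᵇ i) = h

    owns⁻ : ∀ {i u v} → owns i u v ≡ true →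
            u ≢ v × R u ≡ true × R v ≡ true × M u i ≡ true × M v i ≡ true × alsoIn i u v ≡ false
    owns⁻ {i} {u} {v} h =
      let (u≢ᵇv , h₁) = ∧-true⁻ {not (u ≡ᵇ v)} h ; (Ru , h₂) = ∧-true⁻ {R u} h₁ ; (Rv , h₃) = ∧-true⁻ {R v} h₂
          (Mui , h₄) = ∧-true⁻ {M u i} h₃ ; (Mvi , ¬also) = ∧-true⁻ {M v i} h₄
      in ≡ᵇ-false⁻ (not-true⁻ u≢ᵇv) , Ru , Rv , Mui , Mvi , not-true⁻ ¬also

    owns-unique : ∀ {i i′ u v} → owns i u v ≡ true → i′ < W → C i′ ≡ true → M u i′ ≡ true → M v i′ ≡ true → i′ ≡ i
    owns-unique {i} {i′} {u} {v} h i′<W Ci′ Mui′ Mvi′ =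
      ≡ᵇ-true⁻ (not-also (any<-false⁻ W (proj₂ (proj₂ (proj₂ (proj₂ (proj₂ (owns⁻ h)))))) i′ i′<W))
      where
      not-also : not (i′ ≡ᵇ i) ∧ (C i′ ∧ (M u i′ ∧ M v i′)) ≡ false → (i′ ≡ᵇ i) ≡ true
      not-also h rewrite Ci′ | Mui′ | Mvi′ | ∧-identityʳ (not (i′ ≡ᵇ i)) = ¬-not (λ i′≡ᵇi≡false → true≢false (trans (cong not (sym i′≡ᵇi≡false)) h))

    lacksPrivate⁻ : ∀ {i} → lacksPrivate i ≡ true → C i ≡ true × hasPrivate i ≡ false
    lacksPrivate⁻ {i} h = let (Ci , ¬has) = ∧-true⁻ {C i} h in Ci , not-true⁻ ¬has

    row-of-lacking-is-shared : ∀ {u i} → u < N → i < W → lacksPrivate i ≡ true → M u i ≡ true → isPrivate u ≡ false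
    row-of-lacking-is-shared {u} {i} u<N i<W lacking Mui with isPrivate u in priv
    ... | false = refl
    ... | true with any<-true⁻ W priv
    ...   | i′ , _ , privateTo-i′ with privateTo-unique privateTo-i′ i<W (proj₁ (lacksPrivate⁻ lacking)) Mui
    ...     | refl = ⊥-elim (true≢false (trans (sym (any<-true⁺ N u u<N privateTo-i′)) (proj₂ (lacksPrivate⁻ lacking))))

    #private #shared #hasPrivate #lacking privateIncidences : ℕ
    #private = count N (λ u → R u ∧ isPrivate u)
    #shared = count N isShared
    #hasPrivate = count W (λ i → C i ∧ hasPrivate i)
    #lacking = count W lacksPrivate
    privateIncidences = ∑[ i < W ] count N (λ u → privateTo u i)

    hasPrivate≤incidences : ∀ i → i < W → 𝟙 (C i ∧ hasPrivate i) ≤ count N (λ u → privateTo u i)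
    hasPrivate≤incidences i _ with C i ∧ hasPrivate i in has
    ... | false = z≤n
    ... | true = let (u , u<N , private-u) = any<-true⁻ N (proj₂ (∧-true⁻ {C i} has)) in
      subst (_≤ count N (λ u → privateTo u i)) (cong 𝟙 private-u) (term≤∑ N (λ u → 𝟙 (privateTo u i)) u<N)

    incidences≤#private : privateIncidences ≤ #private
    incidences≤#private = ≤-trans (≤-reflexive (∑-comm W N (λ i u → 𝟙 (privateTo u i)))) (∑-mono-≤ N at-most-one)
      where
      at-most-one : ∀ u → u < N → count W (privateTo u) ≤ 𝟙 (R u ∧ isPrivate u)
      at-most-one u u<N with R u ∧ isPrivate u in priv
      ... | true = count-unique W λ i i′ i<W i′<W h h′ →
        let (_ , Ci′ , Mui′ , _) = privateTo⁻ h′ in sym (privateTo-unique h i′<W Ci′ Mui′)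
      ... | false = ≤-reflexive (count-none W none)
        where
        none : ∀ i → i < W → privateTo u i ≡ false
        none i i<W with privateTo u i in h
        ... | false = refl
        ... | true = ⊥-elim (true≢false (trans (sym (∧-true⁺ (proj₁ (privateTo⁻ h)) (any<-true⁺ W i i<W h))) priv))

    rows-split : count N R ≡ #private + #shared
    rows-split = count-split N R isPrivate

    columns-split : count W C ≡ #hasPrivate + #lacking
    columns-split = count-split W C hasPrivate

    sharedPair : ℕ → ℕ → Bool
    sharedPair u v = isShared u ∧ (isShared v ∧ not (v ≡ᵇ u))

    sharedPairs+#shared≡#shared² : ∑[ u < N ] count N (sharedPair u) + #shared ≡ #shared * #shared
    sharedPairs+#shared≡#shared² = begin
      ∑[ u < N ] count N (sharedPair u) + #shared     ≡⟨ ∑-distrib-+ N _ _ ⟨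
      ∑[ u < N ] (count N (sharedPair u) + 𝟙 (isShared u)) ≡⟨ ∑-cong N row ⟩
      ∑[ u < N ] (𝟙 (isShared u) * #shared)          ≡⟨ ∑-𝟙-* N isShared #shared ⟩
      #shared * #shared                               ∎
      where
      open ≡-Reasoning
      row : ∀ u → u < N → count N (sharedPair u) + 𝟙 (isShared u) ≡ 𝟙 (isShared u) * #shared
      row u u<N with isShared u in shared-u
      ... | false = cong (_+ 0) (count-none N (λ _ _ → refl))
      ... | true = trans (+-comm _ 1) (trans (sym (count-remove N u<N shared-u)) (sym (+-identityʳ #shared)))

    -- Rows of a column lacking a private row are shared, and each pair is owned by at most one column.
    ownedByLacking≤sharedPairs : ∑[ i < W ] (𝟙 (lacksPrivate i) * ownedPairs i) ≤ ∑[ u < N ] count N (sharedPair u)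
    ownedByLacking≤sharedPairs = begin
      ∑[ i < W ] (𝟙 (lacksPrivate i) * ownedPairs i)          ≡⟨ ∑-cong W (λ i _ → distribute i) ⟩
      ∑[ i < W ] ∑[ u < N ] count N (lackingOwns i u)         ≡⟨ ∑-comm W N _ ⟩
      ∑[ u < N ] ∑[ i < W ] count N (lackingOwns i u)         ≡⟨ ∑-cong N (λ u _ → ∑-comm W N _) ⟩
      ∑[ u < N ] ∑[ v < N ] ∑[ i < W ] 𝟙 (lackingOwns i u v)  ≤⟨ ∑-mono-≤ N (λ u u<N → ∑-mono-≤ N (λ v v<N → at-most-one u v u<N v<N)) ⟩
      ∑[ u < N ] count N (sharedPair u)                        ∎
      where
      open ≤-Reasoning
      lackingOwns : ℕ → ℕ → ℕ → Bool
      lackingOwns i u v = lacksPrivate i ∧ owns i u v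
      distribute : ∀ i → 𝟙 (lacksPrivate i) * ownedPairs i ≡ ∑[ u < N ] count N (lackingOwns i u)
      distribute i with lacksPrivate i
      ... | true = +-identityʳ (ownedPairs i)
      ... | false = sym (∑-zero N (λ _ _ → count-none N (λ _ _ → refl)))
      lackingOwns⇒shared : ∀ {i u v} → u < N → v < N → i < W → lackingOwns i u v ≡ true → sharedPair u v ≡ true
      lackingOwns⇒shared {i} {u} {v} u<N v<N i<W h with ∧-true⁻ {lacksPrivate i} h
      ... | lacking , owned with owns⁻ {i} {u} {v} owned
      ...   | u≢v , Ru , Rv , Mui , Mvi , _
        rewrite row-of-lacking-is-shared u<N i<W lacking Mui | row-of-lacking-is-shared v<N i<W lacking Mvi
              | Ru | Rv | ≡ᵇ-false⁺ (≢-sym u≢v) = refl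
      at-most-one : ∀ u v → u < N → v < N → count W (λ i → lackingOwns i u v) ≤ 𝟙 (sharedPair u v)
      at-most-one u v u<N v<N with sharedPair u v in shared-uv
      ... | true = count-unique W λ i i′ i<W i′<W h h′ →
        let (_ , owned′) = ∧-true⁻ {lacksPrivate i′} h′
            (_ , _ , _ , Mui′ , Mvi′ , _) = owns⁻ {i′} {u} {v} owned′
            Ci′ = proj₁ (lacksPrivate⁻ (proj₁ (∧-true⁻ {lacksPrivate i′} h′)))
        in sym (owns-unique {i} {i′} {u} {v} (proj₂ (∧-true⁻ {lacksPrivate i} h)) i′<W Ci′ Mui′ Mvi′)
      ... | false = ≤-reflexive (count-none W none)
        where
        none : ∀ i → i < W → lackingOwns i u v ≡ false
        none i i<W with lackingOwns i u v in h
        ... | false = refl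
        ... | true = ⊥-elim (true≢false (trans (sym (lackingOwns⇒shared u<N v<N i<W h)) shared-uv))

    #shared≤#lacking : count N R ≤ count W C → #shared ≤ #lacking
    #shared≤#lacking rows≤columns = +-cancelˡ-≤ #private #shared #lacking (begin
      #private + #shared     ≡⟨ rows-split ⟨
      count N R              ≤⟨ rows≤columns ⟩
      count W C              ≡⟨ columns-split ⟩
      #hasPrivate + #lacking ≤⟨ +-monoˡ-≤ #lacking (≤-trans (∑-mono-≤ W hasPrivate≤incidences) incidences≤#private) ⟩
      #private + #lacking    ∎)
      where open ≤-Reasoning

    -- If each lacking column owned at least q = #shared pairs, then q ⋅ q ≤ #lacking ⋅ q ≤ q ⋅ q - q.
    no-shared-rows : (∀ i → i < W → lacksPrivate i ≡ true → #shared ≤ ownedPairs i) → #shared ≤ #lacking → #shared ≡ 0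
    no-shared-rows many q≤b = n≤0⇒n≡0 (+-cancelˡ-≤ (#shared * #shared) #shared 0 (begin
      #shared * #shared + #shared                           ≤⟨ +-monoˡ-≤ #shared (*-monoˡ-≤ #shared q≤b) ⟩
      #lacking * #shared + #shared                          ≤⟨ +-monoˡ-≤ #shared lacking-owned ⟩
      ∑[ u < N ] count N (sharedPair u) + #shared           ≡⟨ sharedPairs+#shared≡#shared² ⟩
      #shared * #shared                                     ≡⟨ +-identityʳ _ ⟨
      #shared * #shared + 0                                 ∎))
      where
      open ≤-Reasoning
      lacking-owned : #lacking * #shared ≤ ∑[ u < N ] count N (sharedPair u)
      lacking-owned = ≤-trans (≤-reflexive (sym (∑-𝟙-* W lacksPrivate #shared)))
        (≤-trans (∑-mono-≤ W each) ownedByLacking≤sharedPairs)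
        where
        each : ∀ i → i < W → 𝟙 (lacksPrivate i) * #shared ≤ 𝟙 (lacksPrivate i) * ownedPairs i
        each i i<W with lacksPrivate i in lacking
        ... | false = z≤n
        ... | true = +-monoˡ-≤ 0 (many i i<W lacking)

    all-private⇒columns<rows : ∀ {t} → CoverFree t R C → #shared ≡ 0 → HeavyColumn R C → count W C < count N R
    all-private⇒columns<rows cf q≡0 (i₀ , i₀<W , Ci₀ , u₀ , u₀<N , v₀ , v₀<N , u₀≢v₀ , Ru₀ , Rv₀ , Mu₀i₀ , Mv₀i₀) = begin-strict
      count W C              ≡⟨ ∑-cong W (λ i i<W → sym (cong 𝟙 (every-column-has-private i i<W))) ⟩
      #hasPrivate            <⟨ ∑-mono-< W i₀<W hasPrivate≤incidences (<-≤-trans (s≤s (𝟙≤1 (C i₀ ∧ hasPrivate i₀))) two) ⟩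
      privateIncidences      ≤⟨ incidences≤#private ⟩
      #private               ≤⟨ m≤m+n #private #shared ⟩
      #private + #shared     ≡⟨ rows-split ⟨
      count N R              ∎
      where
      open ≤-Reasoning
      private-row : ∀ u → u < N → R u ≡ true → isPrivate u ≡ true
      private-row u u<N Ru with isPrivate u in priv
      ... | true = refl
      ... | false = ⊥-elim (1+n≢0 (n≤0⇒n≡0 (subst₂ _≤_ (cong 𝟙 shared) q≡0 (term≤∑ N (λ u → 𝟙 (isShared u)) u<N))))
        where
        shared : isShared u ≡ true
        shared rewrite Ru | priv = refl
      owner : ∀ u i → u < N → i < W → R u ≡ true → C i ≡ true → M u i ≡ true → privateTo u i ≡ true
      owner u i u<N i<W Ru Ci Mui with any<-true⁻ W (private-row u u<N Ru)
      ... | i′ , _ , private-i′ with privateTo-unique private-i′ i<W Ci Mui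
      ...   | refl = private-i′
      every-column-has-private : ∀ i → i < W → C i ∧ hasPrivate i ≡ C i
      every-column-has-private i i<W = ∧-implied λ Ci →
        let (u , u<N , Ru , Mui) = column-nonempty cf i i<W Ci in any<-true⁺ N u u<N (owner u i u<N i<W Ru Ci Mui)
      two : 2 ≤ count N (λ u → privateTo u i₀)
      two = 2≤∑ N (λ u → 𝟙 (privateTo u i₀)) u₀<N v₀<N u₀≢v₀
        (≤-reflexive (cong 𝟙 (sym (owner u₀ i₀ u₀<N i₀<W Ru₀ Ci₀ Mu₀i₀))))
        (≤-reflexive (cong 𝟙 (sym (owner v₀ i₀ v₀<N i₀<W Rv₀ Ci₀ Mv₀i₀))))

    lacking-column-owning-few-pairs : ∀ {t} → CoverFree t R C → count N R ≤ count W C → HeavyColumn R C →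
                                      ∃ λ A → A < W × lacksPrivate A ≡ true × suc (ownedPairs A) ≤ count N R
    lacking-column-owning-few-pairs cf rows≤columns heavy
      with anyUpTo? (λ i → (lacksPrivate i ≟ᵇ true) ×-dec (ownedPairs i <? #shared)) W
    ... | yes (A , A<W , lacking , few) = A , A<W , lacking , ≤-trans few (subst (#shared ≤_) (sym rows-split) (m≤n+m #shared #private))
    ... | no none = ⊥-elim (<⇒≱ (all-private⇒columns<rows cf q≡0 heavy) rows≤columns)
      where
      q≡0 : #shared ≡ 0
      q≡0 = no-shared-rows (λ i i<W lacking → ≮⇒≥ λ few → none (i , i<W , lacking , few)) (#shared≤#lacking rows≤columns)

    -- The rows of a column A lacking a private row, adjacent when some other column contains both:
    -- non-edges are exactly the pairs owned by A, and a t-cover-free matrix leaves no large matching.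
    module RowsOfLackingColumn {t : ℕ} (cf : CoverFree t R C) {A : ℕ} (A<W : A < W) (lacking : lacksPrivate A ≡ true) where

      inA : ℕ → Bool
      inA u = R u ∧ M u A

      open Enumeration.Enumeration (enumerate N inA) public

      sharesOther : Graph
      sharesOther a b = not (a ≡ᵇ b) ∧ alsoIn A (at a) (at b)

      sharesOther-symmetric : Symmetric sharesOther
      sharesOther-symmetric a b = cong₂ _∧_ (cong not (≡ᵇ-sym a b))
        (any<-cong W (λ j → cong (λ z → not (j ≡ᵇ A) ∧ (C j ∧ z)) (∧-comm (M (at a) j) (M (at b) j))))

      sharesOther-irreflexive : Irreflexive sharesOther
      sharesOther-irreflexive a rewrite ≡ᵇ-refl a = refl

      nonEdges≡ownedPairs : nonEdges size sharesOther ≡ ownedPairs A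
      nonEdges≡ownedPairs = sym (begin
        ownedPairs A                                                      ≡⟨ ∑-cong N (λ u _ → row u) ⟩
        ∑[ u < N ] (if inA u then ∑[ v < N ] (if inA v then h u v else 0) else 0) ≡⟨ ∑-reindex _ ⟩
        ∑[ a < size ] ∑[ v < N ] (if inA v then h (at a) v else 0)       ≡⟨ ∑-cong size (λ a _ → ∑-reindex _) ⟩
        ∑[ a < size ] ∑[ b < size ] h (at a) (at b)                       ≡⟨ ∑-cong size (λ a a<s → ∑-cong size (λ b b<s → entry a b a<s b<s)) ⟩
        nonEdges size sharesOther                                         ∎)
        where
        open ≡-Reasoning
        h : ℕ → ℕ → ℕ
        h u v = 𝟙 (not (u ≡ᵇ v) ∧ not (alsoIn A u v))
        row : ∀ u → count N (owns A u) ≡ (if inA u then ∑[ v < N ] (if inA v then h u v else 0) else 0)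
        row u with inA u in inA-u
        ... | true = ∑-cong N (λ v _ → cell v)
          where
          cell : ∀ v → 𝟙 (owns A u v) ≡ (if inA v then h u v else 0)
          cell v with ∧-true⁻ {R u} inA-u
          ... | Ru , MuA rewrite Ru | MuA with R v | M v A
          ...   | true | true = refl
          ...   | true | false = cong 𝟙 (∧-zeroʳ (not (u ≡ᵇ v)))
          ...   | false | _ = cong 𝟙 (∧-zeroʳ (not (u ≡ᵇ v)))
        ... | false = count-none N not-owned
          where
          not-owned : ∀ v → v < N → owns A u v ≡ false
          not-owned v _ = ¬-not λ owned → let (_ , Ru , _ , MuA , _) = owns⁻ {A} {u} {v} owned in
            true≢false (trans (sym (∧-true⁺ Ru MuA)) inA-u)
        entry : ∀ a b → a < size → b < size → h (at a) (at b) ≡ 𝟙 (not (a ≡ᵇ b) ∧ not (sharesOther a b))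
        entry a b a<s b<s with a ≟ b
        ... | yes refl rewrite ≡ᵇ-refl (at a) | ≡ᵇ-refl a = refl
        ... | no a≢b rewrite ≡ᵇ-false⁺ a≢b | ≡ᵇ-false⁺ (λ eq → a≢b (at-injective a b a<s b<s eq)) = refl

      private
        CA : C A ≡ true
        CA = proj₁ (lacksPrivate⁻ lacking)

        OtherColumn : (ℕ → Bool) → ℕ → Bool
        OtherColumn P j = not (j ≡ᵇ A) ∧ (C j ∧ P j)

        OtherColumn⁻ : ∀ P {j} → OtherColumn P j ≡ true → j ≢ A × C j ≡ true × P j ≡ true
        OtherColumn⁻ P {j} h = let (j≢ᵇA , rest) = ∧-true⁻ {not (j ≡ᵇ A)} h ; (Cj , Pj) = ∧-true⁻ {C j} rest in
          ≡ᵇ-false⁻ (not-true⁻ j≢ᵇA) , Cj , Pj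

        otherColumn : (ℕ → Bool) → ℕ
        otherColumn P = pick W (OtherColumn P)

        otherColumn-spec : ∀ P {j} → j < W → OtherColumn P j ≡ true →
                           (otherColumn P < W × C (otherColumn P) ≡ true × otherColumn P ≢ A) × P (otherColumn P) ≡ true
        otherColumn-spec P j<W h with pick-spec W _ j<W h
        ... | c<W , picked = let (c≢A , Cc , Pc) = OtherColumn⁻ P picked in (c<W , Cc , c≢A) , Pc

        -- a row of A is not private to A, so some other column contains it
        beside : ∀ a → a < size → ∃ λ j → j < W × OtherColumn (M (at a)) j ≡ true
        beside a a<s = let (j , j<W , not-only-A) = all<-false⁻ W not-private in j , j<W , other not-only-A
          where
          u : ℕ
          u = at a
          Ru : R u ≡ true
          Ru = proj₁ (∧-true⁻ (at-∈ a a<s))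
          MuA : M u A ≡ true
          MuA = proj₂ (∧-true⁻ {R u} (at-∈ a a<s))
          not-private : all< W (λ j → (j ≡ᵇ A) ∨ not (C j ∧ M u j)) ≡ false
          not-private = ¬-not λ only-A → true≢false (trans
            (sym (any<-true⁺ N u (at-< a a<s) (∧-true⁺ Ru (∧-true⁺ CA (∧-true⁺ MuA only-A)))))
            (proj₂ (lacksPrivate⁻ lacking)))
          other : ∀ {j} → (j ≡ᵇ A) ∨ not (C j ∧ M u j) ≡ false → OtherColumn (M u) j ≡ true
          other {j} h = let (j≢ᵇA , in-j) = ∨-false⁻ {j ≡ᵇ A} h in ∧-true⁺ (not-true⁺ j≢ᵇA) (not-false⁻ in-j)

        -- a cover of column A: one column per matching edge and one per unmatched row
        module Cover {k : ℕ} (𝓜 : Matching size k sharesOther) where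
          open Matching 𝓜

          bothEnds : ℕ → ℕ → Bool
          bothEnds l j = M (at (left l)) j ∧ M (at (right l)) j

          edgeColumn : ℕ → ℕ
          edgeColumn l = otherColumn (bothEnds l)

          edgeColumn-spec : ∀ l → l < k → (edgeColumn l < W × C (edgeColumn l) ≡ true × edgeColumn l ≢ A) ×
                                           bothEnds l (edgeColumn l) ≡ true
          edgeColumn-spec l l<k = let (j , j<W , h) = any<-true⁻ W (proj₂ (∧-true⁻ {not (left l ≡ᵇ right l)} (edge l l<k)))
                                  in otherColumn-spec (bothEnds l) j<W h

          rowColumn : ℕ → ℕ
          rowColumn a = otherColumn (M (at a))

          rowColumn-spec : ∀ a → a < size → (rowColumn a < W × C (rowColumn a) ≡ true × rowColumn a ≢ A) ×
                                             M (at a) (rowColumn a) ≡ true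
          rowColumn-spec a a<s = let (j , j<W , h) = beside a a<s in otherColumn-spec (M (at a)) j<W h

          cover : List ℕ
          cover = collect (λ _ → true) edgeColumn k ++ collect (λ a → not (matched a)) rowColumn size

          cover-ok : OtherColumns C A cover
          cover-ok = AllP.++⁺ (collect⁺ _ edgeColumn k (λ l l<k _ → proj₁ (edgeColumn-spec l l<k)))
                              (collect⁺ _ rowColumn size (λ a a<s _ → proj₁ (rowColumn-spec a a<s)))

          k+|cover|≤size : k + length cover ≤ size
          k+|cover|≤size = begin
            k + length cover                       ≡⟨ cong (k +_) (trans (length-++ (collect (λ _ → true) edgeColumn k))
                                                       (cong₂ _+_ (trans (length-collect _ edgeColumn k) (count-true k))
                                                                  (length-collect _ rowColumn size))) ⟩
            k + (k + unmatched)                    ≡⟨ +-assoc k k unmatched ⟨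
            (k + k) + unmatched                    ≤⟨ +-monoˡ-≤ unmatched 2k≤#matched ⟩
            count size matched + unmatched         ≡⟨ count-split size (λ _ → true) matched ⟨
            count size (λ _ → true)                ≡⟨ count-true size ⟩
            size                                   ∎
            where
            open ≤-Reasoning
            unmatched : ℕ
            unmatched = count size (λ a → not (matched a))

          meets-every-row : ∀ a → a < size → ¬ All (λ j → M (at a) j ≡ false) cover
          meets-every-row a a<s avoids with matched a in matched-a
          ... | true = let (l , l<k , end) = any<-true⁻ k matched-a in true≢false (trans
            (sym (in-edgeColumn l l<k end)) (collect⁻ _ edgeColumn k (AllP.++⁻ˡ _ avoids) l l<k refl))
            where
            in-edgeColumn : ∀ l → l < k → (left l ≡ᵇ a) ∨ (right l ≡ᵇ a) ≡ true → M (at a) (edgeColumn l) ≡ true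
            in-edgeColumn l l<k end with ∧-true⁻ (proj₂ (edgeColumn-spec l l<k)) | ∨-true⁻ {left l ≡ᵇ a} end
            ... | in-left , _ | inj₁ left≡ᵇa = subst (λ z → M (at z) (edgeColumn l) ≡ true) (≡ᵇ-true⁻ left≡ᵇa) in-left
            ... | _ , in-right | inj₂ right≡ᵇa = subst (λ z → M (at z) (edgeColumn l) ≡ true) (≡ᵇ-true⁻ right≡ᵇa) in-right
          ... | false = true≢false (trans
            (sym (proj₂ (rowColumn-spec a a<s))) (collect⁻ _ rowColumn size (AllP.++⁻ʳ _ avoids) a a<s (not-true⁺ matched-a)))

      no-matching : ∀ k → size ≤ k + t → ¬ Matching size k sharesOther
      no-matching k size≤k+t 𝓜 =
        let (u , u<N , Ru , MuA , avoids) = cf A A<W CA cover cover-ok |cover|≤t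
            (a , a<s , at-a≡u) = at-onto u u<N (∧-true⁺ Ru MuA)
        in meets-every-row a a<s (subst (λ r → All (λ j → M r j ≡ false) cover) (sym at-a≡u) avoids)
        where
        open Cover 𝓜
        |cover|≤t : length cover ≤ t
        |cover|≤t = +-cancelˡ-≤ k _ t (≤-trans k+|cover|≤size size≤k+t)

      t<size : t < size
      t<size = ≰⇒> λ size≤t → no-matching 0 size≤t record
        { left = λ _ → 0 ; right = λ _ → 0 ; left-< = λ _ () ; right-< = λ _ () ; edge = λ _ ()
        ; left-injective = λ _ _ () ; right-injective = λ _ _ () ; left≢right = λ _ _ () }

      egBound≤ownedPairs : size ≤ t + t → ∃ λ j → j < size ∸ t × egBound t j ≤ ownedPairs A
      egBound≤ownedPairs size≤2t = j , j<k , bound′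
        where
        k : ℕ
        k = size ∸ t
        size≤k+t : size ≤ k + t
        size≤k+t = ≤-reflexive (sym (m∸n+n≡m (<⇒≤ t<size)))
        2k≤size : k + k ≤ size
        2k≤size = ≤-trans (+-monoʳ-≤ k (subst (k ≤_) (m+n∸n≡m t t) (∸-monoˡ-≤ t size≤2t)))
                          (≤-reflexive (m∸n+n≡m (<⇒≤ t<size)))
        erdős-gallai : ∃ λ j → j < k × egBound (size ∸ k) j ≤ nonEdges size sharesOther
        erdős-gallai = ¬matching⇒egBound≤nonEdges size k sharesOther sharesOther-symmetric sharesOther-irreflexive
                         2k≤size (no-matching k size≤k+t)
        j : ℕ
        j = proj₁ erdős-gallai
        j<k : j < k
        j<k = proj₁ (proj₂ erdős-gallai)
        size∸k≡t : size ∸ k ≡ t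
        size∸k≡t = m∸[m∸n]≡n (<⇒≤ t<size)
        bound′ : egBound t j ≤ ownedPairs A
        bound′ = subst₂ (λ t′ x → egBound t′ j ≤ x) size∸k≡t nonEdges≡ownedPairs (proj₂ (proj₂ erdős-gallai))

  Light : ℕ → (ℕ → Bool) → (ℕ → Bool) → Set
  Light p R C = ∀ i → i < W → C i ≡ true → ¬ (θ⋅ odd p ≤ columnWeight R i)

  -- With t = p + 2: a lacking column has at most 2 (p + 1) rows, so Erdős–Gallai applies to its graph.
  θ⋅sq≤rows-if-light : ∀ {p R C} → CoverFree (suc (suc p)) R C → count N R ≤ count W C → HeavyColumn R C →
                       Light (suc p) R C → θ⋅ sq (suc (suc p)) ≤ count N R
  θ⋅sq≤rows-if-light {p} {R} {C} cf rows≤columns heavy light = from-lacking (lacking-column-owning-few-pairs cf rows≤columns heavy)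
    where
    open Privacy R C
    t : ℕ
    t = suc (suc p)
    from-lacking : (∃ λ A → A < W × lacksPrivate A ≡ true × suc (ownedPairs A) ≤ count N R) → θ⋅ sq t ≤ count N R
    from-lacking (A , A<W , lacks , few) = from-erdős-gallai (egBound≤ownedPairs size≤2t)
      where
      open RowsOfLackingColumn cf A<W lacks using (size; size≡count; t<size; egBound≤ownedPairs)
      light-A : ¬ (θ⋅ odd (suc p) ≤ size)
      light-A = subst (λ x → ¬ (θ⋅ odd (suc p) ≤ x)) (sym size≡count) (light A A<W (proj₁ (lacksPrivate⁻ lacks)))
      size≤2t : size ≤ t + t
      size≤2t = ≤-trans (≤2p-of-¬θ⋅odd≤ (suc p) light-A) (+-mono-≤ (n≤1+n (suc p)) (n≤1+n (suc p)))
      from-erdős-gallai : (∃ λ j → j < size ∸ t × egBound t j ≤ ownedPairs A) → θ⋅ sq t ≤ count N R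
      from-erdős-gallai (j , j<size∸t , eg≤owned) = θ⋅≤-mono
        (subst (_≤ count N R) (+-comm 1 (egBound t j)) (≤-trans (s≤s eg≤owned) few))
        (egBound-clears-threshold (suc p) j (s≤s z≤n) light-t+1+j)
        where
        light-t+1+j : ¬ (θ⋅ odd (suc p) ≤ t + suc j)
        light-t+1+j big = light-A (θ⋅≤-mono (≤-trans (+-monoʳ-≤ t j<size∸t) (≤-reflexive (m+[n∸m]≡n (<⇒≤ t<size)))) big)

  -- Deleting a heaviest column A with its s rows leaves at least θ (p + 1)² rows by induction, so if
  -- there are fewer than θ (p + 2)² rows in all, then s < θ (2p + 3) and every column is light.
  heavy⇒θ⋅sq≤rows : ∀ p {R C} → CoverFree (suc p) R C → count N R ≤ count W C → HeavyColumn R C →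
                    θ⋅ sq (suc p) ≤ count N R
  heavy⇒θ⋅sq≤rows zero {R} cf _ (_ , _ , _ , u , u<N , _ , _ , _ , Ru , _) =
    θ⋅≤-of-≤ (s≤s z≤n) (subst (_≤ count N R) (cong 𝟙 Ru) (term≤∑ N (λ u → 𝟙 (R u)) u<N))
  heavy⇒θ⋅sq≤rows (suc p) {R} {C} cf rows≤columns heavy@(i , i<W , Ci , u , u<N , v , v<N , u≢v , Ru , Rv , Mui , Mvi)
    with θ⋅?≤? (sq (suc (suc p))) (count N R)
  ... | yes above = above
  ... | no ¬above = ⊥-elim (¬above (θ⋅sq≤rows-if-light cf rows≤columns heavy
                                     (light (argmax W C (columnWeight R) (i , i<W , Ci)))))
    where
    light : (∃ λ A → A < W × C A ≡ true × (∀ i → i < W → C i ≡ true → columnWeight R i ≤ columnWeight R A)) →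
            Light (suc p) R C
    light (A , A<W , CA , maximal) i′ i′<W Ci′ big = ¬above (subst (θ⋅ sq (suc (suc p)) ≤_) (sym (count-rowsOutside R A))
      (θ⋅sq-suc≤ induction (θ⋅≤-mono (maximal i′ i′<W Ci′) big)))
      where
      R′ C′ : ℕ → Bool
      R′ = rowsOutside R A
      C′ = columnsExcept C A
      2≤weight : 2 ≤ columnWeight R A
      2≤weight = ≤-trans (2≤∑ N (λ w → 𝟙 (R w ∧ M w i)) u<N v<N u≢v
        (≤-reflexive (cong 𝟙 (sym (∧-true⁺ Ru Mui)))) (≤-reflexive (cong 𝟙 (sym (∧-true⁺ Rv Mvi))))) (maximal i i<W Ci)
      rows′<columns′ : count N R′ < count W C′
      rows′<columns′ = s≤s⁻¹ (begin
        suc (suc (count N R′))          ≡⟨ +-comm 2 (count N R′) ⟩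
        count N R′ + 2                  ≤⟨ +-monoʳ-≤ (count N R′) 2≤weight ⟩
        count N R′ + columnWeight R A   ≡⟨ count-rowsOutside R A ⟨
        count N R                       ≤⟨ rows≤columns ⟩
        count W C                       ≡⟨ count-remove W A<W CA ⟩
        suc (count W C′)                ∎)
        where open ≤-Reasoning
      cf′ : CoverFree (suc p) R′ C′
      cf′ = CoverFree-delete cf A<W CA
      induction : θ⋅ sq (suc p) ≤ count N R′
      induction = heavy⇒θ⋅sq≤rows p cf′ (<⇒≤ rows′<columns′) (fewer-rows⇒heavy cf′ rows′<columns′)

open import Defs
open import Data.Nat using (ℕ; suc; _<_; _≤_; _<?_)
open import Data.Nat.Properties using (≤-refl; n<1+n; anyUpTo?)
open import Data.Bool using (Bool; true; false)
open import Data.Bool.Properties using () renaming (_≟_ to _≟ᵇ_)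
open import Data.Fin using (Fin; toℕ; fromℕ<; punchOut)
open import Data.Fin.Properties using (toℕ-injective; toℕ<n; toℕ-fromℕ<; fromℕ<-toℕ; any?; pigeonhole; punchOut-injective)
import Data.Fin.Properties as Fin
open import Data.List using (List; []; _∷_; length)
open import Data.List.Relation.Unary.All as All using (All; []; _∷_; all?)
open import Data.List.Relation.Unary.Any using (here; there)
open import Data.List.Membership.Propositional using (_∈_; _∉_)
open import Data.Product using (∃; _×_; _,_; proj₁; proj₂)
open import Data.Empty using (⊥-elim)
open import Function.Bundles using (_↔_; _⇔_; mk⇔; mk↔ₛ′; Equivalence)
open import Relation.Nullary using (¬_; yes; no)
open import Relation.Nullary.Decidable using (_×-dec_)
open import Relation.Binary.PropositionalEquality
open Counting using (count-true)
open Threshold using (θ⋅_≤_; sq; θ⋅sq≤⇒¬BelowBound)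

-- A value y missed by f would let f, punched out at y, squeeze Fin (m + 1) into Fin m.
private
  no-missing-value : ∀ {m} (f : Fin (suc m) → Fin (suc m)) → (∀ {x y} → f x ≡ f y → x ≡ y) →
                     ∀ y → ¬ (∀ x → y ≢ f x)
  no-missing-value {m} f f-injective y y≢f with pigeonhole (n<1+n m) (λ x → punchOut (y≢f x))
  ... | i , j , i<j , same = Fin.<-irrefl (f-injective (punchOut-injective (y≢f i) (y≢f j) same)) i<j

injective⇒surjective : ∀ {n} (f : Fin n → Fin n) → (∀ {x y} → f x ≡ f y → x ≡ y) → ∀ y → ∃ λ x → f x ≡ y
injective⇒surjective {suc m} f f-injective y with any? (λ x → f x Fin.≟ y)
... | yes hit = hit
... | no missed = ⊥-elim (no-missing-value f f-injective y (λ x y≡fx → missed (x , sym y≡fx)))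

unique-ones⇒permutation : ∀ {n} (M : Matrix n n) → DistinctColumns M →
                          (∀ v → ∃ λ u → ∀ w → M w v ≡ true ⇔ w ≡ u) → IsPermutationMatrix M
unique-ones⇒permutation {n} M distinct one = σ , λ u v → proj₂ (one v) u
  where
  σ→ : Fin n → Fin n
  σ→ v = proj₁ (one v)
  σ→-injective : ∀ {v v′} → σ→ v ≡ σ→ v′ → v ≡ v′
  σ→-injective {v} {v′} same with v Fin.≟ v′
  ... | yes v≡v′ = v≡v′
  ... | no v≢v′ = ⊥-elim (distinct v v′ v≢v′ λ u → bool-ext (mk⇔
    (λ Muv → Equivalence.from (proj₂ (one v′) u) (trans (Equivalence.to (proj₂ (one v) u) Muv) same))
    (λ Muv′ → Equivalence.from (proj₂ (one v) u) (trans (Equivalence.to (proj₂ (one v′) u) Muv′) (sym same)))))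
    where
    bool-ext : ∀ {a b} → a ≡ true ⇔ b ≡ true → a ≡ b
    bool-ext {true} a⇔b = sym (Equivalence.to a⇔b refl)
    bool-ext {false} {true} a⇔b = Equivalence.from a⇔b refl
    bool-ext {false} {false} _ = refl
  σ← : Fin n → Fin n
  σ← u = proj₁ (injective⇒surjective σ→ σ→-injective u)
  σ : Fin n ↔ Fin n
  σ = mk↔ₛ′ σ→ σ← (λ u → proj₂ (injective⇒surjective σ→ σ→-injective u))
                  (λ v → σ→-injective (proj₂ (injective⇒surjective σ→ σ→-injective (σ→ v))))

module _ {n : ℕ} (M : Matrix n n) where

  -- M read as a function on ℕ, with zeros outside n × n
  entry : ℕ → ℕ → Bool
  entry u v with u <? n | v <? n
  ... | yes u<n | yes v<n = M (fromℕ< u<n) (fromℕ< v<n)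
  ... | _ | _ = false

  entry-toℕ : ∀ x y → entry (toℕ x) (toℕ y) ≡ M x y
  entry-toℕ x y with toℕ x <? n | toℕ y <? n
  ... | yes x<n | yes y<n = cong₂ M (fromℕ<-toℕ x x<n) (fromℕ<-toℕ y y<n)
  ... | no x≮n | _ = ⊥-elim (x≮n (toℕ<n x))
  ... | yes _ | no y≮n = ⊥-elim (y≮n (toℕ<n y))

  entry-fromℕ< : ∀ x {j} (j<n : j < n) → entry (toℕ x) j ≡ M x (fromℕ< j<n)
  entry-fromℕ< x j<n = trans (cong (entry (toℕ x)) (sym (toℕ-fromℕ< j<n))) (entry-toℕ x (fromℕ< j<n))

  open CoverFree n n entry using (CoverFree; HeavyColumn; rowOf; rowOf-spec; rowOf-unique)

  everything : ℕ → Bool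
  everything _ = true

  toFin : (S : List ℕ) → All (_< n) S → List (Fin n)
  toFin [] [] = []
  toFin (j ∷ S) (j<n ∷ S<n) = fromℕ< j<n ∷ toFin S S<n

  length-toFin : ∀ S S<n → length (toFin S S<n) ≡ length S
  length-toFin [] [] = refl
  length-toFin (j ∷ S) (_ ∷ S<n) = cong suc (length-toFin S S<n)

  toFin-∉ : ∀ {i} (i<n : i < n) S S<n → All (_≢ i) S → fromℕ< i<n ∉ toFin S S<n
  toFin-∉ i<n (j ∷ S) (j<n ∷ _) (j≢i ∷ _) (here i≡j) =
    j≢i (trans (sym (toℕ-fromℕ< j<n)) (trans (cong toℕ (sym i≡j)) (toℕ-fromℕ< i<n)))
  toFin-∉ i<n (j ∷ S) (_ ∷ S<n) (_ ∷ S≢i) (there i∈S) = toFin-∉ i<n S S<n S≢i i∈S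

  one-in : ∀ (u : Fin n) S S<n → ¬ All (λ j → entry (toℕ u) j ≡ false) S → ∃ λ j → j ∈ toFin S S<n × M u j ≡ true
  one-in u [] [] not-all = ⊥-elim (not-all [])
  one-in u (j ∷ S) (j<n ∷ S<n) not-all with entry (toℕ u) j in Muj
  ... | true = fromℕ< j<n , here refl , trans (sym (entry-fromℕ< u j<n)) Muj
  ... | false = let (j′ , j′∈S , Muj′) = one-in u S S<n (λ all-S → not-all (Muj ∷ all-S)) in j′ , there j′∈S , Muj′

  Disjunct⇒CoverFree : ∀ {t} → Disjunct t M → CoverFree t everything everything
  Disjunct⇒CoverFree (_ , uncovered) i i<n _ S S-ok |S|≤t
    with anyUpTo? (λ u → (entry u i ≟ᵇ true) ×-dec all? (λ j → entry u j ≟ᵇ false) S) n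
  ... | yes (u , u<n , Mui , avoids) = u , u<n , refl , Mui , avoids
  ... | no none = ⊥-elim (uncovered (fromℕ< i<n) (toFin S S<n) (subst (_≤ _) (sym (length-toFin S S<n)) |S|≤t)
                    (toFin-∉ i<n S S<n (All.map (λ (_ , _ , j≢i) → j≢i) S-ok)) covered)
    where
    S<n : All (_< n) S
    S<n = All.map proj₁ S-ok
    covered : ∀ u → M u (fromℕ< i<n) ≡ true → ∃ λ j → j ∈ toFin S S<n × M u j ≡ true
    covered u Mui = one-in u S S<n λ avoids → none (toℕ u , toℕ<n u , trans (entry-fromℕ< u i<n) Mui , avoids)

  singleton-columns : ∀ {t} → CoverFree t everything everything → ¬ HeavyColumn everything everything →
                      ∀ v → ∃ λ u → ∀ w → M w v ≡ true ⇔ w ≡ u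
  singleton-columns cf ¬heavy v = fromℕ< ρ<n , λ w → mk⇔
    (λ Mwv → toℕ-injective (trans (rowOf-unique cf ¬heavy (toℕ v) (toℕ<n v) refl (toℕ w) (toℕ<n w) refl
                                     (trans (entry-toℕ w v) Mwv))
                                  (sym (toℕ-fromℕ< ρ<n))))
    (λ { refl → trans (sym (entry-toℕ (fromℕ< ρ<n) v)) (subst (λ x → entry x (toℕ v) ≡ true) (sym (toℕ-fromℕ< ρ<n)) Mρv) })
    where
    ρ<n : rowOf everything (toℕ v) < n
    ρ<n = proj₁ (rowOf-spec cf (toℕ v) (toℕ<n v) refl)
    Mρv : entry (rowOf everything (toℕ v)) (toℕ v) ≡ true
    Mρv = proj₂ (proj₂ (rowOf-spec cf (toℕ v) (toℕ<n v) refl))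

theorem5p2 : (t n : ℕ) → 0 < t → 1 < n → BelowBound t n →
    (M : Matrix n n) → Disjunct t M → IsPermutationMatrix M
theorem5p2 (suc p) n _ _ below M disjunct = unique-ones⇒permutation M (proj₁ disjunct) (singleton-columns M cf ¬heavy)
  where
  open CoverFree n n (entry M) using (CoverFree; HeavyColumn; heavy⇒θ⋅sq≤rows)
  cf : CoverFree (suc p) (everything M) (everything M)
  cf = Disjunct⇒CoverFree M disjunct
  ¬heavy : ¬ HeavyColumn (everything M) (everything M)
  ¬heavy heavy = θ⋅sq≤⇒¬BelowBound {suc p} θt²≤n below
    where
    θt²≤n : θ⋅ sq (suc p) ≤ n
    θt²≤n = subst (θ⋅ sq (suc p) ≤_) (count-true n) (heavy⇒θ⋅sq≤rows p cf ≤-refl heavy)
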